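{- The QCNFs $\mathtt{QParity}_n$ have polynomial-size $\mathsf{QCDCL}^{\textsf{LEV-ORD}}_{\textsf{RED}}$ refutations.
   Context: $\mathtt{QParity}_n$ is the QCNF with prefix $\exists x_1\dots x_n\,\forall z\,\exists t_2\dots t_n$ and matrix consisting of the clauses $x_1\vee x_2\vee\bar t_2$, $x_1\vee\bar x_2\vee t_2$, $\bar x_1\vee x_2\vee t_2$, $\bar x_1\vee\bar x_2\vee\bar t_2$; for $i\in\{3,\dots,n\}$ the clauses $x_i\vee t_{i-1}\vee\bar t_i$, $x_i\vee\bar t_{i-1}\vee t_i$, $\bar x_i\vee t_{i-1}\vee t_i$, $\bar x_i\vee\bar t_{i-1}\vee\bar t_i$; and $t_n\vee z$, $\bar t_n\vee\bar z$. QBF/QCDCL notions. A QCNF is $\Phi=\mathcal{Q}\cdot\phi$ with prefix $Q_1X_1\dots Q_sX_s$ (alternating quantifier blocks) and CNF matrix $\phi$ of non-tautological clauses; $\mathrm{lv}(x)=i$ if the variable of $x$ is in $X_i$. $\mathrm{red}(C)$ deletes from a clause $C$ every universal literal $v$ with $\mathrm{lv}(v)>\mathrm{lv}(x)$ for all existential $x\in C$. For existential $\ell$: $(C_1\vee\ell)\otimes_\ell(C_2\vee\bar\ell)=C_1\vee C_2$. $C|_\sigma=\top$ if $C\cap\sigma\neq\emptyset$, else the clause of $\ell\in C$ with $\bar\ell\notin\sigma$. A trail is $\mathcal{T}=(p_{(0,1)},\dots,p_{(0,g_0)};d_1,p_{(1,1)},\dots;\dots;d_r,p_{(r,1)},\dots,p_{(r,g_r)})$,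 a sequence of literals with no variable occurring twice; $d_i$ decisions, $p_{(i,j)}$ propagated literals (existential, or $\bot$ only as last element: a conflict); $\mathcal{T}[s,t]$ is the initial segment ending at $p_{(s,t)}$ (at $d_s$ if $t=0$; $\mathcal{T}[0,0]$ empty); $|\mathcal{T}|$ its number of elements. RED: each $p_{(i,j)}$ has antecedent $\mathrm{ante}(p_{(i,j)})$ in the current clause set with $\mathrm{red}(\mathrm{ante}(p_{(i,j)})|_{\mathcal{T}[i,j-1]})=(p_{(i,j)})$ ($(\bot)$ = empty clause). LEV-ORD: $\mathrm{lv}(d_i)\le\mathrm{lv}(x)$ for all variables $x$ unassigned in $\mathcal{T}[i-1,g_{i-1}]$. A clause is unit if its reduct is $(x)$ with $x$ existential or is empty ($x=\bot$). Natural condition at an initial segment without $\bot$: if some clauses are unit under it, the next element is the literal of one of them with that clause as antecedent, and is $\bot$ if possible. Learnable clauses of a trail ending in $\bot$: start with $\mathrm{red}(\mathrm{ante}(\bot))$, and go leftwards over propagated $p$: current clause $C'$ becomes $\mathrm{red}(C'\otimes_p\mathrm{red}(\mathrm{ante}(p)))$ if $\bar p\in C'$, else stays; $\mathcal{L}_\mathcal{T}$ is the sequence of clauses so obtained. A $\mathsf{QCDCL}^{\textsf{LEV-ORD}}_{\textsf{RED}}$ refutation of $\Phi=\mathcal{Q}\cdot\phi$ consists of trails $\mathcal{T}_1,\dots,\mathcal{T}_m$ and clauses $C_1,\dots,C_m=(\bot)$ (with their derivations) where $\mathcal{T}_i$ is a LEV-ORD/RED trail for $\mathcal{Q}\cdot(\phi\cup\{C_1,\dots,C_{i-1}\})$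 that has run into a conflict, $C_i\in\mathcal{L}_{\mathcal{T}_i}$, $\mathcal{T}_1$ satisfies the natural condition everywhere, and for $i\ge2$ some $(s,t)$ has $\mathcal{T}_i[s,t]=\mathcal{T}_{i-1}[s,t]$ and $\mathcal{T}_i$ satisfies the natural condition at all initial segments extending $\mathcal{T}_i[s,t]$. Its size is $\sum_i|\mathcal{T}_i|$. -}

module Defs where

open import Data.Nat using (ℕ; zero; suc; _+_; _*_; _∸_; _^_; _≤_; _≤ᵇ_; _≡ᵇ_)
open import Data.Bool using (Bool; true; false; _∧_; _∨_; not; if_then_else_; T)
open import Data.List using (List; []; _∷_; _++_; map; concat; concatMap; length; take; reverse; applyUpTo)
open import Data.Nat.ListAction using (sum)
open import Data.Bool.ListAction using (any)
open import Data.List.Membership.Propositional using (_∈_; _∉_)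
open import Data.List.Relation.Unary.All using (All)
open import Data.Maybe using (Maybe; just; nothing)
open import Data.Product using (Σ; _×_; _,_; ∃; ∃-syntax; proj₁; proj₂)
open import Data.Unit using (⊤)
open import Data.Empty using (⊥)
open import Relation.Binary.PropositionalEquality using (_≡_)
open import Relation.Nullary using (¬_)
open import Relation.Nullary.Decidable using (⌊_⌋)
open import Function using (_∘_)

Var : Set
Var = ℕ

Lit : Set
Lit = ℕ × Bool

var : Lit → Var
var = proj₁

pos neg : Var → Lit
pos v = v , true
neg v = v , false

~_ : Lit → Lit
~ (v , b) = v , not b

eqBool : Bool → Bool → Bool
eqBool true  true  = true
eqBool false false = true
eqBool _     _     = false

litEq : Lit → Lit → Bool
litEq (v , b) (w , c) = (v ≡ᵇ w) ∧ eqBool b c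

memLit : Lit → List Lit → Bool
memLit ℓ = any (litEq ℓ)

memVar : Var → List Var → Bool
memVar v = any (v ≡ᵇ_)

-- a clause is a (finite) list of literals, read as a set (disjunction)
Clause : Set
Clause = List Lit

data Quant : Set where
  ∃q ∀q : Quant

Prefix : Set
Prefix = List (Quant × List Var)

-- block index (1-based) and quantifier of a variable
blockOf′ : ℕ → Prefix → Var → Maybe (ℕ × Quant)
blockOf′ i []              v = nothing
blockOf′ i ((q , X) ∷ P)   v = if memVar v X then just (i , q) else blockOf′ (suc i) P v

blockOf : Prefix → Var → Maybe (ℕ × Quant)
blockOf = blockOf′ 1

lv : Prefix → Var → ℕ
lv P v with blockOf P v
... | just (i , _) = i
... | nothing      = 0

isEx : Prefix → Var → Bool
isEx P v with blockOf P v
... | just (_ , ∃q) = true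
... | _             = false

isUniv : Prefix → Var → Bool
isUniv P v with blockOf P v
... | just (_ , ∀q) = true
... | _             = false

vars : Prefix → List Var
vars = concatMap proj₂

record QCNF : Set where
  constructor _·_
  field
    prefix : Prefix
    matrix : List Clause
open QCNF public

filterᵇ : (Lit → Bool) → Clause → Clause
filterᵇ f [] = []
filterᵇ f (x ∷ xs) = if f x then x ∷ filterᵇ f xs else filterᵇ f xs

red : Prefix → Clause → Clause
red P C = filterᵇ keep C
  where
  blocked : Lit → Bool
  blocked ℓ = any (λ x → isEx P (var x) ∧ (lv P (var ℓ) ≤ᵇ lv P (var x))) C
  keep : Lit → Bool
  keep ℓ = not (isUniv P (var ℓ)) ∨ blocked ℓ

-- resolution on existential literal p :  (C₁ ∨ ¬p) ⊗ (C₂ ∨ p) = C₁ ∨ C₂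
-- (first argument contains ¬p, second contains p)
resolve : Lit → Clause → Clause → Clause
resolve p C D = filterᵇ (λ ℓ → not (litEq ℓ (~ p))) C ++ filterᵇ (λ ℓ → not (litEq ℓ p)) D

-- restriction C|σ : nothing stands for ⊤
restrict : List Lit → Clause → Maybe Clause
restrict σ C =
  if any (λ ℓ → memLit ℓ σ) C then nothing
  else just (filterᵇ (λ ℓ → not (memLit (~ ℓ) σ)) C)

reduct : Prefix → List Lit → Clause → Maybe Clause
reduct P σ C with restrict σ C
... | nothing = nothing
... | just D  = just (red P D)

-- C is unit under σ with literal p (just p), or with ⊥ (nothing):
-- red(C|σ) = (p) with p existential, resp. red(C|σ) = (⊥) (empty clause).
UnitFor : Prefix → List Lit → Clause → Maybe Lit → Set
UnitFor P σ C (just p) =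
  Σ Clause λ D → reduct P σ C ≡ just D × T (isEx P (var p)) × p ∈ D × All (_≡ p) D
UnitFor P σ C nothing = reduct P σ C ≡ just []

data Entry : Set where
  dec   : Lit → Entry
  prop  : Lit → Clause → Entry
  confl : Clause → Entry

Trail : Set
Trail = List Entry

assigned : Trail → List Lit
assigned [] = []
assigned (dec d ∷ τ)    = d ∷ assigned τ
assigned (prop p _ ∷ τ) = p ∷ assigned τ
assigned (confl _ ∷ τ)  = assigned τ

assignedVars : Trail → List Var
assignedVars = map var ∘ assigned

-- conditions on an element e of a trail, preceded by the segment pre and
-- followed by post, for the current clause set S (RED, LEV-ORD, no
-- variable twice, ⊥ only as last element)
EntryOK : Prefix → List Clause → Trail → Entry → Trail → Set
EntryOK P S pre (dec d) post =
  var d ∈ vars P × var d ∉ assignedVars pre ×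
  (∀ y → y ∈ vars P → y ∉ assignedVars pre → lv P (var d) ≤ lv P y)
EntryOK P S pre (prop p A) post =
  A ∈ S × var p ∉ assignedVars pre × UnitFor P (assigned pre) A (just p)
EntryOK P S pre (confl A) post =
  A ∈ S × UnitFor P (assigned pre) A nothing × post ≡ []

record ConflictTrail (P : Prefix) (S : List Clause) (τ : Trail) : Set where
  field
    entriesOK : ∀ pre e post → τ ≡ pre ++ e ∷ post → EntryOK P S pre e post
    endsInConflict : ∃[ pre ] ∃[ A ] τ ≡ pre ++ confl A ∷ []

NotDecision : Entry → Set
NotDecision (dec _) = ⊥
NotDecision _       = ⊤

IsConflict : Entry → Set
IsConflict (confl _) = ⊤
IsConflict _         = ⊥

NaturalAt : Prefix → List Clause → Trail → Entry → Set
NaturalAt P S pre e =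
  ((∃[ A ] ∃[ m ] (A ∈ S × UnitFor P (assigned pre) A m)) → NotDecision e) ×
  ((∃[ A ] (A ∈ S × UnitFor P (assigned pre) A nothing)) → IsConflict e)

NaturalFrom : Prefix → List Clause → ℕ → Trail → Set
NaturalFrom P S k τ =
  ∀ pre e post → τ ≡ pre ++ e ∷ post → k ≤ length pre → NaturalAt P S pre e

-- shape of an entry, forgetting antecedents (for comparing segments)
shape : Entry → Bool × Maybe Lit
shape (dec d)    = true , just d
shape (prop p _) = false , just p
shape (confl _)  = false , nothing

-- input: the propagated/decided entries from right to left; current clause C'
learnSeq : Prefix → Trail → Clause → List Clause
learnSeq P []               C = C ∷ []
learnSeq P (dec _ ∷ es)     C = learnSeq P es C
learnSeq P (confl _ ∷ es)   C = learnSeq P es C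
learnSeq P (prop p A ∷ es)  C =
  C ∷ learnSeq P es (if memLit (~ p) C then red P (resolve p C (red P A)) else C)

learnR : Prefix → Trail → List Clause
learnR P (confl A ∷ es) = learnSeq P es (red P A)
learnR P _              = []

Learnable : Prefix → Trail → List Clause
Learnable P τ = learnR P (reverse τ)

Restart : Prefix → List Clause → Trail → Trail → Set
Restart P S τprev τ =
  ∃[ k ] (k ≤ length τ × k ≤ length τprev ×
          take k (map shape τ) ≡ take k (map shape τprev) × NaturalFrom P S k τ)

-- the steps 2..m: clause set S, previous trail τprev
data Chain (P : Prefix) : List Clause → Trail → List (Trail × Clause) → Set where
  done : ∀ {S τprev} → Chain P S τprev []
  step : ∀ {S τprev τ C rest} →
         ConflictTrail P S τ → C ∈ Learnable P τ → Restart P S τprev τ →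
         Chain P (S ++ C ∷ []) τ rest →
         Chain P S τprev ((τ , C) ∷ rest)

finalClause : Clause → List (Trail × Clause) → Clause
finalClause C [] = C
finalClause _ ((_ , C′) ∷ r) = finalClause C′ r

record Refutation (Φ : QCNF) : Set where
  field
    trail₁  : Trail
    clause₁ : Clause
    rest    : List (Trail × Clause)
    trail₁OK   : ConflictTrail (prefix Φ) (matrix Φ) trail₁
    natural₁   : NaturalFrom (prefix Φ) (matrix Φ) 0 trail₁
    learnt₁    : clause₁ ∈ Learnable (prefix Φ) trail₁
    chain      : Chain (prefix Φ) (matrix Φ ++ clause₁ ∷ []) trail₁ rest
    endsEmpty  : finalClause clause₁ rest ≡ []

size : ∀ {Φ} → Refutation Φ → ℕ
size R = length (Refutation.trail₁ R) + sum (map (length ∘ proj₁) (Refutation.rest R))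

module QParityVars (n : ℕ) where
  x : ℕ → Var
  x i = i
  z : Var
  z = 0
  t : ℕ → Var
  t i = n + i

QParityPrefix : ℕ → Prefix
QParityPrefix n =
  (∃q , applyUpTo (λ j → x (suc j)) n) ∷
  (∀q , z ∷ []) ∷
  (∃q , applyUpTo (λ j → t (2 + j)) (n ∸ 1)) ∷ []
  where open QParityVars n

QParityMatrix : ℕ → List Clause
QParityMatrix n =
  (pos (x 1) ∷ pos (x 2) ∷ neg (t 2) ∷ []) ∷
  (pos (x 1) ∷ neg (x 2) ∷ pos (t 2) ∷ []) ∷
  (neg (x 1) ∷ pos (x 2) ∷ pos (t 2) ∷ []) ∷
  (neg (x 1) ∷ neg (x 2) ∷ neg (t 2) ∷ []) ∷
  (concat (applyUpTo (λ j → block (3 + j)) (n ∸ 2)) ++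
  ((pos (t n) ∷ pos z ∷ []) ∷
   (neg (t n) ∷ neg z ∷ []) ∷ []))
  where
  open QParityVars n
  block : ℕ → List Clause
  block i =
    (pos (x i) ∷ pos (t (i ∸ 1)) ∷ neg (t i) ∷ []) ∷
    (pos (x i) ∷ neg (t (i ∸ 1)) ∷ pos (t i) ∷ []) ∷
    (neg (x i) ∷ pos (t (i ∸ 1)) ∷ pos (t i) ∷ []) ∷
    (neg (x i) ∷ neg (t (i ∸ 1)) ∷ neg (t i) ∷ []) ∷ []

QParity : ℕ → QCNF
QParity n = QParityPrefix n · QParityMatrix n

-- Write x_j ↦ j, z ↦ 0, t_j ↦ n + j, and let p_j be the variable preceding t_j in the parity
-- chain (x_1 for j = 2, t_{j-1} otherwise).  Going down from j = n, the refutation learns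
-- clauses P_j ⊆ t_j ∨ z and N_j ⊆ ¬t_j ∨ ¬z (up to the polarity of z; the predicate TZ),
-- starting from the matrix clauses t_n ∨ z and ¬t_n ∨ ¬z.  Every trail begins by deciding
-- x_1, x_2, … := 0 (the prefix zeros, along which all t_i := 0 are propagated), and level j
-- takes four trails, each restarting from a prefix of the previous one:
--   C: zeros, x_j := 0, ¬t_j, conflict on P_j                      learns x_j ∨ p_j
--   D: zeros, x_j by that clause, t_j, conflict on N_j              learns P_{j-1}
--   A: x_{j-1} := 1, t_{j-1}, x_j := 0, t_j, conflict on N_j        learns x_j ∨ ¬t_{j-1}
--   B: x_{j-1} := 1, t_{j-1}, x_j by that clause, ¬t_j, conflict on P_j   learns N_{j-1}
-- (the clauses x_j ∨ p_j^± form the predicate XP).  The universal z survives reduction in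
-- these resolvents because t_{j-1} is existential in the last block; at j = 2 the remaining
-- literal x_1 is in the first block, so z is reduced away, and two more trails E, F learn x_1,
-- x_2 ∨ ¬x_1 and the empty clause.  The decisions are natural because, while only x_1 … x_a
-- are assigned, no matrix clause and no clause learnt at a level above a is unit.  Every trail
-- has at most 2n + 5 entries and there are four per level, hence size ≤ 20 n².

module Submission where

open import Defs
open import Data.Nat using (ℕ; zero; suc; _+_; _∸_; _*_; _^_; _≤_; _<_; z≤n; s≤s; z<s; sz<ss; _≡ᵇ_; _≤ᵇ_)
open import Data.Nat.Properties
open import Data.Nat.ListAction using (sum)
open import Data.Nat.Tactic.RingSolver using (solve-∀)
open import Data.Bool using (Bool; true; false; _∧_; _∨_; not; if_then_else_; T; _xor_)
open import Data.Bool.Properties using (∨-zeroʳ; ∨-identityʳ; not-involutive; ¬-not; not-¬; T-≡; T-∧)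
open import Data.Bool.ListAction using (any)
open import Data.List using (List; []; _∷_; _++_; map; length; take; reverse; applyUpTo; concat)
open import Data.List.Properties using (++-assoc; ++-identityʳ; ∷-injective; reverse-++; length-++-≤ˡ; length-++)
open import Data.List.Membership.Propositional using (_∈_; _∉_; find; lose)
open import Data.List.Membership.Propositional.Properties using (∈-++⁻; ∈-++⁺ˡ; ∈-++⁺ʳ; ∈-map⁻; ∈-applyUpTo⁺; ∈-applyUpTo⁻; ∈-concat⁻′; ∈-concat⁺′)
open import Data.List.Relation.Unary.Any using (here; there)
open import Data.List.Relation.Unary.Any.Properties using (any⁺; any⁻)
open import Data.List.Relation.Unary.All using (lookup; tabulate)
open import Data.Maybe using (just; nothing)
open import Data.Maybe.Properties using (just-injective)
open import Data.Product using (Σ; _×_; _,_; ∃-syntax; proj₁; proj₂)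
import Data.Product as Product
open import Data.Sum using (_⊎_; inj₁; inj₂)
import Data.Sum as Sum
open import Data.Empty using (⊥; ⊥-elim)
open import Data.Unit using (⊤; tt)
open import Function using (_∘_)
open import Function.Bundles using (Equivalence)
open import Relation.Binary.PropositionalEquality
open import Relation.Nullary using (¬_; yes; no)

≡true⇒T : ∀ {b} → b ≡ true → T b
≡true⇒T = Equivalence.from T-≡

T⇒≡true : ∀ {b} → T b → b ≡ true
T⇒≡true = Equivalence.to T-≡

true≢false : true ≢ false
true≢false ()

any-witness : ∀ {A : Set} (p : A → Bool) xs → any p xs ≡ true → ∃[ x ] (x ∈ xs × p x ≡ true)
any-witness p xs e with x , x∈xs , px ← find (any⁻ p xs (≡true⇒T e)) = x , x∈xs , T⇒≡true px

any-intro : ∀ {A : Set} (p : A → Bool) {x} xs → x ∈ xs → p x ≡ true → any p xs ≡ true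
any-intro p xs x∈xs px = T⇒≡true (any⁺ p (lose x∈xs (≡true⇒T px)))

any-none : ∀ {A : Set} (p : A → Bool) xs → (∀ {x} → x ∈ xs → p x ≡ false) → any p xs ≡ false
any-none p xs none = ¬-not λ e → let _ , x∈xs , px = any-witness p xs e in true≢false (trans (sym px) (none x∈xs))

eqBool-refl : ∀ b → eqBool b b ≡ true
eqBool-refl true = refl
eqBool-refl false = refl

eqBool⇒≡ : ∀ b c → eqBool b c ≡ true → b ≡ c
eqBool⇒≡ true true _ = refl
eqBool⇒≡ false false _ = refl

litEq-refl : ∀ ℓ → litEq ℓ ℓ ≡ true
litEq-refl (v , b) rewrite T⇒≡true (≡⇒≡ᵇ v v refl) = eqBool-refl b

litEq⇒≡ : ∀ ℓ ℓ′ → litEq ℓ ℓ′ ≡ true → ℓ ≡ ℓ′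
litEq⇒≡ (v , b) (w , c) e with v≡w , b≡c ← Equivalence.to T-∧ (≡true⇒T e)
  rewrite ≡ᵇ⇒≡ v w v≡w | eqBool⇒≡ b c (T⇒≡true b≡c) = refl

≢⇒litEq-false : ∀ ℓ ℓ′ → ℓ ≢ ℓ′ → litEq ℓ ℓ′ ≡ false
≢⇒litEq-false ℓ ℓ′ ℓ≢ℓ′ = ¬-not (ℓ≢ℓ′ ∘ litEq⇒≡ ℓ ℓ′)

∈⇒memLit : ∀ {ℓ C} → ℓ ∈ C → memLit ℓ C ≡ true
∈⇒memLit {ℓ} {C} ℓ∈C = any-intro (litEq ℓ) C ℓ∈C (litEq-refl ℓ)

memLit⇒∈ : ∀ {ℓ C} → memLit ℓ C ≡ true → ℓ ∈ C
memLit⇒∈ {ℓ} {C} e with ℓ′ , ℓ′∈C , eq ← any-witness (litEq ℓ) C e rewrite litEq⇒≡ ℓ ℓ′ eq = ℓ′∈C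

∉⇒memLit-false : ∀ {ℓ C} → ℓ ∉ C → memLit ℓ C ≡ false
∉⇒memLit-false ℓ∉C = ¬-not (ℓ∉C ∘ memLit⇒∈)

∈⇒memVar : ∀ {v xs} → v ∈ xs → memVar v xs ≡ true
∈⇒memVar {v} {xs} v∈xs = any-intro (v ≡ᵇ_) xs v∈xs (T⇒≡true (≡⇒≡ᵇ v v refl))

memVar⇒∈ : ∀ {v xs} → memVar v xs ≡ true → v ∈ xs
memVar⇒∈ {v} {xs} e with w , w∈xs , eq ← any-witness (v ≡ᵇ_) xs e rewrite ≡ᵇ⇒≡ v w (≡true⇒T eq) = w∈xs

∉⇒memVar-false : ∀ {v xs} → v ∉ xs → memVar v xs ≡ false
∉⇒memVar-false v∉xs = ¬-not (v∉xs ∘ memVar⇒∈)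

∈-filterᵇ⁻ : ∀ f {ℓ} C → ℓ ∈ filterᵇ f C → ℓ ∈ C × f ℓ ≡ true
∈-filterᵇ⁻ f (x ∷ C) m with f x in eq
∈-filterᵇ⁻ f (x ∷ C) (here refl) | true = here refl , eq
∈-filterᵇ⁻ f (x ∷ C) (there m) | true = Product.map₁ there (∈-filterᵇ⁻ f C m)
∈-filterᵇ⁻ f (x ∷ C) m | false = Product.map₁ there (∈-filterᵇ⁻ f C m)

∈-filterᵇ⁺ : ∀ f {ℓ} C → ℓ ∈ C → f ℓ ≡ true → ℓ ∈ filterᵇ f C
∈-filterᵇ⁺ f (x ∷ C) (here refl) e rewrite e = here refl
∈-filterᵇ⁺ f (x ∷ C) (there m) e with f x
... | true = there (∈-filterᵇ⁺ f C m e)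
... | false = ∈-filterᵇ⁺ f C m e

no-member⇒≡[] : ∀ {A : Set} (xs : List A) → (∀ {x} → x ∉ xs) → xs ≡ []
no-member⇒≡[] [] _ = refl
no-member⇒≡[] (x ∷ xs) none = ⊥-elim (none (here refl))

not≡true⇒≡false : ∀ {b} → not b ≡ true → b ≡ false
not≡true⇒≡false {false} _ = refl

isEx⇒¬isUniv : ∀ P v → isEx P v ≡ true → isUniv P v ≡ false
isEx⇒¬isUniv P v e with blockOf P v
... | just (_ , ∃q) = refl
isEx⇒¬isUniv P v () | just (_ , ∀q)
isEx⇒¬isUniv P v () | nothing

isUniv⇒¬isEx : ∀ P v → isUniv P v ≡ true → isEx P v ≡ false
isUniv⇒¬isEx P v e with blockOf P v
... | just (_ , ∀q) = refl
isUniv⇒¬isEx P v () | just (_ , ∃q)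
isUniv⇒¬isEx P v () | nothing

Unassigned : List Lit → Var → Set
Unassigned σ v = ∀ c → (v , c) ∉ σ

≡ᵇ-refl : ∀ m → (m ≡ᵇ m) ≡ true
≡ᵇ-refl m = T⇒≡true (≡⇒≡ᵇ m m refl)

<⇒≡ᵇ-false : ∀ {j k} → j < k → (j ≡ᵇ k) ≡ false
<⇒≡ᵇ-false {j} {k} lt = ¬-not (λ e → <⇒≢ lt (≡ᵇ⇒≡ j k (≡true⇒T e)))

>⇒≡ᵇ-false : ∀ {j k} → k < j → (j ≡ᵇ k) ≡ false
>⇒≡ᵇ-false {j} {k} lt = ¬-not (λ e → <⇒≢ lt (sym (≡ᵇ⇒≡ j k (≡true⇒T e))))

~-involutive : ∀ ℓ → ~ (~ ℓ) ≡ ℓ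
~-involutive (v , true) = refl
~-involutive (v , false) = refl

Unassigned⇒∉vars : ∀ {σ v} → Unassigned σ v → v ∉ map var σ
Unassigned⇒∉vars u m with ∈-map⁻ var m
... | (w , c) , m' , refl = u c m'

∈-∷ʳ : ∀ {A : Set} (S : List A) {C} → C ∈ S ++ C ∷ []
∈-∷ʳ S = ∈-++⁺ʳ S (here refl)

∈-∷ʳ-elim : ∀ {A : Set} {Q : A → Set} {S : List A} {C} → (∀ {D} → D ∈ S → Q D) → Q C → ∀ {D} → D ∈ S ++ C ∷ [] → Q D
∈-∷ʳ-elim {S = S} h q m with ∈-++⁻ S m
... | inj₁ m' = h m'
... | inj₂ (here refl) = q

∷ʳ-assoc₂ : ∀ {A : Set} (xs : List A) a b → (xs ++ a ∷ []) ++ b ∷ [] ≡ xs ++ a ∷ b ∷ []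
∷ʳ-assoc₂ xs a b = ++-assoc xs (a ∷ []) (b ∷ [])

∷ʳ-assoc₃ : ∀ {A : Set} (xs : List A) a b c → ((xs ++ a ∷ []) ++ b ∷ []) ++ c ∷ [] ≡ xs ++ a ∷ b ∷ c ∷ []
∷ʳ-assoc₃ xs a b c = trans (cong (_++ c ∷ []) (∷ʳ-assoc₂ xs a b)) (++-assoc xs (a ∷ b ∷ []) (c ∷ []))

∷ʳ-assoc₄ : ∀ {A : Set} (xs : List A) a b c d → (((xs ++ a ∷ []) ++ b ∷ []) ++ c ∷ []) ++ d ∷ [] ≡ xs ++ a ∷ b ∷ c ∷ d ∷ []
∷ʳ-assoc₄ xs a b c d = trans (cong (_++ d ∷ []) (∷ʳ-assoc₃ xs a b c)) (++-assoc xs (a ∷ b ∷ c ∷ []) (d ∷ []))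

module Reduction (P : Prefix) where

  blockedIn : Clause → Lit → Bool
  blockedIn C ℓ = any (λ x → isEx P (var x) ∧ (lv P (var ℓ) ≤ᵇ lv P (var x))) C

  keptIn : Clause → Lit → Bool
  keptIn C ℓ = not (isUniv P (var ℓ)) ∨ blockedIn C ℓ

  red-⊆ : ∀ {ℓ} C → ℓ ∈ red P C → ℓ ∈ C
  red-⊆ C ℓ∈ = proj₁ (∈-filterᵇ⁻ (keptIn C) C ℓ∈)

  ∈-red⁺-nonUniv : ∀ {ℓ} C → ℓ ∈ C → isUniv P (var ℓ) ≡ false → ℓ ∈ red P C
  ∈-red⁺-nonUniv {ℓ} C ℓ∈C e = ∈-filterᵇ⁺ (keptIn C) C ℓ∈C (cong (λ b → not b ∨ blockedIn C ℓ) e)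

  ∈-red⁺-blocked : ∀ {ℓ ℓ′} C → ℓ ∈ C → ℓ′ ∈ C → isEx P (var ℓ′) ≡ true → lv P (var ℓ) ≤ lv P (var ℓ′) →
                   ℓ ∈ red P C
  ∈-red⁺-blocked {ℓ} {ℓ′} C ℓ∈C ℓ′∈C ex le = ∈-filterᵇ⁺ (keptIn C) C ℓ∈C kept
    where
    blocked : blockedIn C ℓ ≡ true
    blocked = any-intro _ C ℓ′∈C (T⇒≡true (Equivalence.from T-∧ (≡true⇒T ex , ≤⇒≤ᵇ le)))
    kept : keptIn C ℓ ≡ true
    kept rewrite blocked = ∨-zeroʳ _

  ∈-red-univ⇒blocker : ∀ {ℓ} C → ℓ ∈ red P C → isUniv P (var ℓ) ≡ true →
                       ∃[ ℓ′ ] (ℓ′ ∈ C × isEx P (var ℓ′) ≡ true × lv P (var ℓ) ≤ lv P (var ℓ′))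
  ∈-red-univ⇒blocker {ℓ} C ℓ∈ u with ∈-filterᵇ⁻ (keptIn C) C ℓ∈
  ... | _ , kept rewrite u with ℓ′ , ℓ′∈C , q ← any-witness _ C kept
                           with ex , le ← Equivalence.to T-∧ (≡true⇒T q) =
    ℓ′ , ℓ′∈C , T⇒≡true ex , ≤ᵇ⇒≤ _ _ le

  restrictLits : List Lit → Clause → Clause
  restrictLits σ C = filterᵇ (λ ℓ → not (memLit (~ ℓ) σ)) C

  restrict-unsat : ∀ σ C → (∀ {ℓ} → ℓ ∈ C → ℓ ∉ σ) → restrict σ C ≡ just (restrictLits σ C)
  restrict-unsat σ C unsat rewrite any-none (λ ℓ → memLit ℓ σ) C (∉⇒memLit-false ∘ unsat) = refl

  restrict≡just⁻ : ∀ σ C {D} → restrict σ C ≡ just D → D ≡ restrictLits σ C × (∀ {ℓ} → ℓ ∈ C → ℓ ∉ σ)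
  restrict≡just⁻ σ C e with any (λ ℓ → memLit ℓ σ) C in sat
  restrict≡just⁻ σ C () | true
  ... | false = sym (just-injective e) , λ ℓ∈C ℓ∈σ →
          true≢false (trans (sym (any-intro (λ ℓ → memLit ℓ σ) C ℓ∈C (∈⇒memLit ℓ∈σ))) sat)

  restrict-sat : ∀ σ C {ℓ} → ℓ ∈ C → ℓ ∈ σ → restrict σ C ≡ nothing
  restrict-sat σ C ℓ∈C ℓ∈σ rewrite any-intro (λ ℓ → memLit ℓ σ) C ℓ∈C (∈⇒memLit ℓ∈σ) = refl

  reduct≡just⁻ : ∀ σ C {D} → reduct P σ C ≡ just D → Σ Clause λ D₀ → restrict σ C ≡ just D₀ × red P D₀ ≡ D
  reduct≡just⁻ σ C e with restrict σ C
  ... | just D₀ = D₀ , refl , just-injective e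

  reduct-sat : ∀ σ C {ℓ} → ℓ ∈ C → ℓ ∈ σ → reduct P σ C ≡ nothing
  reduct-sat σ C ℓ∈C ℓ∈σ with restrict σ C | restrict-sat σ C ℓ∈C ℓ∈σ
  ... | nothing | _ = refl

  reduct-unsat : ∀ σ C → (∀ {ℓ} → ℓ ∈ C → ℓ ∉ σ) → reduct P σ C ≡ just (red P (restrictLits σ C))
  reduct-unsat σ C unsat with restrict σ C | restrict-unsat σ C unsat
  ... | just _ | refl = refl

  ∈-restrictLits⁺ : ∀ σ C {ℓ} → ℓ ∈ C → Unassigned σ (var ℓ) → ℓ ∈ restrictLits σ C
  ∈-restrictLits⁺ σ C {ℓ} ℓ∈C u = ∈-filterᵇ⁺ _ C ℓ∈C (cong not (∉⇒memLit-false (u (not (proj₂ ℓ)))))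

  ∈-restrictLits⁻ : ∀ σ C {ℓ} → ℓ ∈ restrictLits σ C → ℓ ∈ C × (~ ℓ) ∉ σ
  ∈-restrictLits⁻ σ C ℓ∈ with ℓ∈C , kept ← ∈-filterᵇ⁻ _ C ℓ∈ =
    ℓ∈C , λ ~ℓ∈σ → true≢false (trans (sym (∈⇒memLit ~ℓ∈σ)) (not≡true⇒≡false kept))

  Survives : List Lit → Clause → Lit → Set
  Survives σ C ℓ = isUniv P (var ℓ) ≡ false ⊎
    (∃[ ℓ′ ] (ℓ′ ∈ C × Unassigned σ (var ℓ′) × isEx P (var ℓ′) ≡ true × lv P (var ℓ) ≤ lv P (var ℓ′)))

  survives⇒∈reduct : ∀ σ C {D ℓ} → reduct P σ C ≡ just D → ℓ ∈ C → Unassigned σ (var ℓ) → Survives σ C ℓ → ℓ ∈ D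
  survives⇒∈reduct σ C e ℓ∈C u s with reduct≡just⁻ σ C e
  ... | _ , r , refl with refl , _ ← restrict≡just⁻ σ C r with s
  ... | inj₁ nonUniv = ∈-red⁺-nonUniv _ (∈-restrictLits⁺ σ C ℓ∈C u) nonUniv
  ... | inj₂ (ℓ′ , ℓ′∈C , u′ , ex , le) =
    ∈-red⁺-blocked _ (∈-restrictLits⁺ σ C ℓ∈C u) (∈-restrictLits⁺ σ C ℓ′∈C u′) ex le

  NotUnit : List Lit → Clause → Set
  NotUnit σ C = ∀ m → ¬ UnitFor P σ C m

  satisfied⇒NotUnit : ∀ σ C {ℓ} → ℓ ∈ C → ℓ ∈ σ → NotUnit σ C
  satisfied⇒NotUnit σ C ℓ∈C ℓ∈σ (just p) (_ , e , _) with () ← trans (sym (reduct-sat σ C ℓ∈C ℓ∈σ)) e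
  satisfied⇒NotUnit σ C ℓ∈C ℓ∈σ nothing e with () ← trans (sym (reduct-sat σ C ℓ∈C ℓ∈σ)) e

  survivors⇒NotUnit : ∀ σ C {ℓ₁ ℓ₂} → ℓ₁ ∈ C → ℓ₂ ∈ C → ℓ₁ ≢ ℓ₂ →
                      Unassigned σ (var ℓ₁) → Unassigned σ (var ℓ₂) →
                      Survives σ C ℓ₁ → Survives σ C ℓ₂ → NotUnit σ C
  survivors⇒NotUnit σ C ℓ₁∈C ℓ₂∈C ℓ₁≢ℓ₂ u₁ u₂ s₁ s₂ (just p) (_ , e , _ , _ , onlyP) =
    ℓ₁≢ℓ₂ (trans (lookup onlyP (survives⇒∈reduct σ C e ℓ₁∈C u₁ s₁))
                 (sym (lookup onlyP (survives⇒∈reduct σ C e ℓ₂∈C u₂ s₂))))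
  survivors⇒NotUnit σ C ℓ₁∈C _ _ u₁ _ s₁ _ nothing e with () ← survives⇒∈reduct σ C e ℓ₁∈C u₁ s₁

  survivor⇒¬conflict : ∀ σ C {ℓ} → ℓ ∈ C → Unassigned σ (var ℓ) → Survives σ C ℓ → ¬ UnitFor P σ C nothing
  survivor⇒¬conflict σ C ℓ∈C u s e with () ← survives⇒∈reduct σ C e ℓ∈C u s

  natural-decision : ∀ {S} pre d → (∀ {C} → C ∈ S → NotUnit (assigned pre) C) → NaturalAt P S pre (dec d)
  natural-decision pre d h = (λ { (A , m , mA , u) → h mA m u }) , (λ { (A , mA , u) → h mA nothing u })

  natural-propagation : ∀ {S} pre p A → (∀ {C} → C ∈ S → ¬ UnitFor P (assigned pre) C nothing) → NaturalAt P S pre (prop p A)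
  natural-propagation pre p A h = (λ _ → tt) , (λ { (A , mA , u) → h mA u })

  natural-conflict : ∀ {S pre A} → NaturalAt P S pre (confl A)
  natural-conflict = (λ _ → tt) , (λ _ → tt)

  UnitCond : List Lit → Lit → Lit → Set
  UnitCond σ p ℓ = ℓ ∉ σ × (ℓ ≡ p ⊎ (~ ℓ) ∈ σ ⊎ (isUniv P (var ℓ) ≡ true × lv P (var p) < lv P (var ℓ)))

  unit-intro : ∀ σ C p → p ∈ C → isEx P (var p) ≡ true → (~ p) ∉ σ →
               (∀ {ℓ} → ℓ ∈ C → UnitCond σ p ℓ) → UnitFor P σ C (just p)
  unit-intro σ C p p∈C ex ~p∉σ cond =
    red P (restrictLits σ C) , reduct-unsat σ C (proj₁ ∘ cond) , ≡true⇒T ex ,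
    ∈-red⁺-nonUniv _ (∈-filterᵇ⁺ _ C p∈C (cong not (∉⇒memLit-false ~p∉σ))) (isEx⇒¬isUniv P (var p) ex) ,
    tabulate onlyP
    where
    onlyP : ∀ {x} → x ∈ red P (restrictLits σ C) → x ≡ p
    onlyP x∈ with x∈C , ~x∉σ ← ∈-restrictLits⁻ σ C (red-⊆ _ x∈) with proj₂ (cond x∈C)
    ... | inj₁ x≡p = x≡p
    ... | inj₂ (inj₁ ~x∈σ) = ⊥-elim (~x∉σ ~x∈σ)
    ... | inj₂ (inj₂ (u , lt)) with ℓ′ , ℓ′∈ , ex′ , le ← ∈-red-univ⇒blocker _ x∈ u
                               with ℓ′∈C , ~ℓ′∉σ ← ∈-restrictLits⁻ σ C ℓ′∈ with proj₂ (cond ℓ′∈C)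
    ... | inj₁ refl = ⊥-elim (<⇒≱ lt le)
    ... | inj₂ (inj₁ ~ℓ′∈σ) = ⊥-elim (~ℓ′∉σ ~ℓ′∈σ)
    ... | inj₂ (inj₂ (u′ , _)) = ⊥-elim (true≢false (trans (sym ex′) (isUniv⇒¬isEx P _ u′)))

  conflict-intro : ∀ σ C → (∀ {ℓ} → ℓ ∈ C → ℓ ∉ σ × ((~ ℓ) ∈ σ ⊎ isUniv P (var ℓ) ≡ true)) →
                   UnitFor P σ C nothing
  conflict-intro σ C cond = trans (reduct-unsat σ C (proj₁ ∘ cond)) (cong just (no-member⇒≡[] _ empty))
    where
    empty : ∀ {x} → x ∉ red P (restrictLits σ C)
    empty x∈ with x∈C , ~x∉σ ← ∈-restrictLits⁻ σ C (red-⊆ _ x∈) with proj₂ (cond x∈C)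
    ... | inj₁ ~x∈σ = ~x∉σ ~x∈σ
    ... | inj₂ u with ℓ′ , ℓ′∈ , ex′ , _ ← ∈-red-univ⇒blocker _ x∈ u
                 with ℓ′∈C , ~ℓ′∉σ ← ∈-restrictLits⁻ σ C ℓ′∈ with proj₂ (cond ℓ′∈C)
    ... | inj₁ ~ℓ′∈σ = ~ℓ′∉σ ~ℓ′∈σ
    ... | inj₂ u′ = true≢false (trans (sym ex′) (isUniv⇒¬isEx P _ u′))

AllAfter : (Trail → Entry → Set) → Trail → Trail → Set
AllAfter Q acc [] = ⊤
AllAfter Q acc (e ∷ es) = Q acc e × AllAfter Q (acc ++ e ∷ []) es

AllAfter-++ : ∀ Q acc xs ys → AllAfter Q acc xs → AllAfter Q (acc ++ xs) ys → AllAfter Q acc (xs ++ ys)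
AllAfter-++ Q acc [] ys _ h = subst (λ a → AllAfter Q a ys) (++-identityʳ acc) h
AllAfter-++ Q acc (x ∷ xs) ys (q , h1) h2 =
  q , AllAfter-++ Q (acc ++ x ∷ []) xs ys h1 (subst (λ a → AllAfter Q a ys) (sym (++-assoc acc (x ∷ []) xs)) h2)

length-∷ʳ : ∀ {A : Set} (xs : List A) x → length (xs ++ x ∷ []) ≡ suc (length xs)
length-∷ʳ [] x = refl
length-∷ʳ (y ∷ xs) x = cong suc (length-∷ʳ xs x)

length-<-∷ : ∀ {A : Set} (xs : List A) {e : A} ys → length xs < length (xs ++ e ∷ ys)
length-<-∷ [] ys = z<s
length-<-∷ (x ∷ xs) ys = s≤s (length-<-∷ xs ys)

++-∷-injective : ∀ {A : Set} (pre acc : List A) {e x : A} {post xs} → pre ++ e ∷ post ≡ acc ++ x ∷ xs →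
           length pre ≡ length acc → pre ≡ acc × e ≡ x
++-∷-injective [] [] refl _ = refl , refl
++-∷-injective (p ∷ pre) (a ∷ acc) eq l with ∷-injective eq
... | refl , eq' with ++-∷-injective pre acc eq' (suc-injective l)
... | refl , refl = refl , refl

AllAfter-lookup : ∀ Q acc es → AllAfter Q acc es → ∀ pre e post → pre ++ e ∷ post ≡ acc ++ es → length acc ≤ length pre → Q pre e
AllAfter-lookup Q acc [] _ pre e post eq le =
  ⊥-elim (<-irrefl refl (≤-trans (length-<-∷ pre post) (≤-trans (≤-reflexive (cong length (trans eq (++-identityʳ acc)))) le)))
AllAfter-lookup Q acc (x ∷ xs) (q , h) pre e post eq le with length acc ≟ length pre
... | yes l with ++-∷-injective pre acc eq (sym l)
... | refl , refl = q
AllAfter-lookup Q acc (x ∷ xs) (q , h) pre e post eq le | no l =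
  AllAfter-lookup Q (acc ++ x ∷ []) xs h pre e post (trans eq (sym (++-assoc acc (x ∷ []) xs)))
    (subst (_≤ length pre) (sym (length-∷ʳ acc x)) (≤∧≢⇒< le l))

∷ʳ-split : ∀ {A : Set} (body pre : List A) {c e : A} {post} → body ++ c ∷ [] ≡ pre ++ e ∷ post →
  (pre ≡ body × e ≡ c × post ≡ []) ⊎ (∃[ post' ] (body ≡ pre ++ e ∷ post'))
∷ʳ-split [] [] refl = inj₁ (refl , refl , refl)
∷ʳ-split [] (p ∷ pre) eq with ∷-injective eq
∷ʳ-split [] (p ∷ []) eq | _ , ()
∷ʳ-split [] (p ∷ (_ ∷ _)) eq | _ , ()
∷ʳ-split (b ∷ body) [] refl = inj₂ (body , refl)
∷ʳ-split (b ∷ body) (p ∷ pre) eq with ∷-injective eq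
... | refl , eq' with ∷ʳ-split body pre eq'
... | inj₁ (refl , refl , refl) = inj₁ (refl , refl , refl)
... | inj₂ (post' , refl) = inj₂ (post' , refl)

EntryOKBefore : Prefix → List Clause → Trail → Entry → Set
EntryOKBefore P S pre (dec d) = EntryOK P S pre (dec d) []
EntryOKBefore P S pre (prop p A) = EntryOK P S pre (prop p A) []
EntryOKBefore P S pre (confl A) = ⊥

conflictTrail : ∀ P S body A → AllAfter (EntryOKBefore P S) [] body → A ∈ S → UnitFor P (assigned body) A nothing →
       ConflictTrail P S (body ++ confl A ∷ [])
conflictTrail P S body A ev mA uA = record { entriesOK = ok ; endsInConflict = body , A , refl }
  where
  ok : ∀ pre e post → body ++ confl A ∷ [] ≡ pre ++ e ∷ post → EntryOK P S pre e post
  ok pre e post eq with ∷ʳ-split body pre eq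
  ... | inj₁ (refl , refl , refl) = mA , uA , refl
  ... | inj₂ (post' , beq) with AllAfter-lookup (EntryOKBefore P S) [] body ev pre e post' (sym beq) z≤n
  ok pre (dec d) post eq | inj₂ _ | q = q
  ok pre (prop p A') post eq | inj₂ _ | q = q
  ok pre (confl A') post eq | inj₂ _ | ()

conflictTrail-++ : ∀ P S sh ext A → AllAfter (EntryOKBefore P S) [] (sh ++ ext) → A ∈ S → UnitFor P (assigned (sh ++ ext)) A nothing →
        ConflictTrail P S (sh ++ (ext ++ confl A ∷ []))
conflictTrail-++ P S sh ext A ev mA u = subst (ConflictTrail P S) (++-assoc sh ext (confl A ∷ [])) (conflictTrail P S (sh ++ ext) A ev mA u)

naturalFrom : ∀ P S sh ext → AllAfter (NaturalAt P S) sh ext → NaturalFrom P S (length sh) (sh ++ ext)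
naturalFrom P S sh ext ev pre e post eq le = AllAfter-lookup (NaturalAt P S) sh ext ev pre e post (sym eq) le

take-length-map : ∀ {A B : Set} (f : A → B) (xs : List A) ys → take (length xs) (map f (xs ++ ys)) ≡ map f xs
take-length-map f [] ys = refl
take-length-map f (x ∷ xs) ys = cong (f x ∷_) (take-length-map f xs ys)

restart : ∀ P S sh ext τprev ext' → τprev ≡ sh ++ ext' → AllAfter (NaturalAt P S) sh ext → Restart P S τprev (sh ++ ext)
restart P S sh ext τprev ext' refl ev =
  length sh , length-++-≤ˡ sh , length-++-≤ˡ sh ,
  trans (take-length-map shape sh ext) (sym (take-length-map shape sh ext')) , naturalFrom P S sh ext ev

restart′ : ∀ P S sh ext τ τprev ext' → τ ≡ sh ++ ext → τprev ≡ sh ++ ext' → AllAfter (NaturalAt P S) sh ext → Restart P S τprev τ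
restart′ P S sh ext τ τprev ext' refl e2 ev = restart P S sh ext τprev ext' e2 ev

assigned-++ : ∀ xs ys → assigned (xs ++ ys) ≡ assigned xs ++ assigned ys
assigned-++ [] ys = refl
assigned-++ (dec d ∷ xs) ys = cong (d ∷_) (assigned-++ xs ys)
assigned-++ (prop p A ∷ xs) ys = cong (p ∷_) (assigned-++ xs ys)
assigned-++ (confl A ∷ xs) ys = assigned-++ xs ys

learnStep : Prefix → Lit → Clause → Clause → Clause
learnStep P p A C = if memLit (~ p) C then red P (resolve p C (red P A)) else C

learnSeq-head : ∀ P es C → C ∈ learnSeq P es C
learnSeq-head P [] C = here refl
learnSeq-head P (dec _ ∷ es) C = learnSeq-head P es C
learnSeq-head P (confl _ ∷ es) C = learnSeq-head P es C
learnSeq-head P (prop p A ∷ es) C = here refl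

Learnable-++ : ∀ P sh ext → Learnable P (sh ++ ext) ≡ learnR P (reverse ext ++ reverse sh)
Learnable-++ P sh ext = cong (learnR P) (reverse-++ sh ext)

not-litEq⇒≢ : ∀ {ℓ q} → not (litEq ℓ q) ≡ true → ℓ ≢ q
not-litEq⇒≢ {ℓ} e refl rewrite litEq-refl ℓ = true≢false (sym e)

∈-resolve⁻ : ∀ p C D {ℓ} → ℓ ∈ resolve p C D → (ℓ ∈ C × ℓ ≢ (~ p)) ⊎ (ℓ ∈ D × ℓ ≢ p)
∈-resolve⁻ p C D m with ∈-++⁻ (filterᵇ (λ ℓ → not (litEq ℓ (~ p))) C) m
... | inj₁ a = let (x , y) = ∈-filterᵇ⁻ _ C a in inj₁ (x , not-litEq⇒≢ y)
... | inj₂ b = let (x , y) = ∈-filterᵇ⁻ _ D b in inj₂ (x , not-litEq⇒≢ y)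

∈-resolve⁺ˡ : ∀ p C D {ℓ} → ℓ ∈ C → ℓ ≢ (~ p) → ℓ ∈ resolve p C D
∈-resolve⁺ˡ p C D {ℓ} m ne = ∈-++⁺ˡ (∈-filterᵇ⁺ _ C m (cong not (≢⇒litEq-false ℓ (~ p) ne)))

∈-resolve⁺ʳ : ∀ p C D {ℓ} → ℓ ∈ D → ℓ ≢ p → ℓ ∈ resolve p C D
∈-resolve⁺ʳ p C D {ℓ} m ne = ∈-++⁺ʳ (filterᵇ (λ ℓ → not (litEq ℓ (~ p))) C) (∈-filterᵇ⁺ _ D m (cong not (≢⇒litEq-false ℓ p ne)))

learnStep-resolves : ∀ P p A C → (~ p) ∈ C → learnStep P p A C ≡ red P (resolve p C (red P A))
learnStep-resolves P p A C m rewrite ∈⇒memLit m = refl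

module QParityRefutation (n : ℕ) (2≤n : 2 ≤ n) where

  P : Prefix
  P = QParityPrefix n

  xVars : List ℕ
  xVars = applyUpTo (λ j → QParityVars.x n (suc j)) n
  tVars : List ℕ
  tVars = applyUpTo (λ j → QParityVars.t n (2 + j)) (n ∸ 1)

  blockOf-QParity : ∀ v → blockOf P v ≡ (if memVar v xVars then just (1 , ∃q) else
                            (if memVar v (0 ∷ []) then just (2 , ∀q) else
                            (if memVar v tVars then just (3 , ∃q) else nothing)))
  blockOf-QParity v = refl

  x∈xVars : ∀ {j} → 1 ≤ j → j ≤ n → j ∈ xVars
  x∈xVars {suc i} _ le = ∈-applyUpTo⁺ (λ j → QParityVars.x n (suc j)) le

  blockOf-x : ∀ {j} → 1 ≤ j → j ≤ n → blockOf P j ≡ just (1 , ∃q)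
  blockOf-x {j} a b rewrite blockOf-QParity j | ∈⇒memVar (x∈xVars a b) = refl

  x≢t : ∀ {i j} → i ≤ n → 1 ≤ j → i ≢ n + j
  x≢t i≤n 1≤j refl = <⇒≱ (m<m+n n 1≤j) i≤n

  t∉xVars : ∀ {j} → 1 ≤ j → n + j ∉ xVars
  t∉xVars h m with ∈-applyUpTo⁻ (λ j → QParityVars.x n (suc j)) m
  ... | i , i<n , eq = x≢t i<n h (sym eq)

  z∉xVars : 0 ∉ xVars
  z∉xVars m with ∈-applyUpTo⁻ (λ j → QParityVars.x n (suc j)) m
  ... | i , i<n , ()

  t∈tVars : ∀ {j} → 2 ≤ j → j ≤ n → n + j ∈ tVars
  t∈tVars {suc zero} (s≤s ()) _
  t∈tVars {suc (suc k)} _ le = ∈-applyUpTo⁺ (λ j → QParityVars.t n (2 + j)) {k} (lem le)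
    where lem : ∀ {k n} → suc (suc k) ≤ n → k < n ∸ 1
          lem {k} {suc n} (s≤s le) = le

  t≢z : ∀ {j} → 1 ≤ j → n + j ∉ (0 ∷ [])
  t≢z h (here eq) = x≢t z≤n h (sym eq)

  blockOf-t : ∀ {j} → 2 ≤ j → j ≤ n → blockOf P (n + j) ≡ just (3 , ∃q)
  blockOf-t {j} a b rewrite blockOf-QParity (n + j) | ∉⇒memVar-false (t∉xVars {j} (≤-trans z<s a)) | ∉⇒memVar-false (t≢z {j} (≤-trans z<s a))
                   | ∈⇒memVar (t∈tVars a b) = refl

  blockOf-z : blockOf P 0 ≡ just (2 , ∀q)
  blockOf-z rewrite blockOf-QParity 0 | ∉⇒memVar-false z∉xVars = refl

  lv-of : ∀ {v i q} → blockOf P v ≡ just (i , q) → lv P v ≡ i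
  lv-of {v} e with blockOf P v
  lv-of refl | .(just _) = refl

  ex-of : ∀ {v i} → blockOf P v ≡ just (i , ∃q) → isEx P v ≡ true
  ex-of {v} e with blockOf P v
  ex-of refl | .(just _) = refl

  un-of : ∀ {v i} → blockOf P v ≡ just (i , ∀q) → isUniv P v ≡ true
  un-of {v} e with blockOf P v
  un-of refl | .(just _) = refl

  lv-x : ∀ {j} → 1 ≤ j → j ≤ n → lv P j ≡ 1
  lv-x {j} a b = lv-of {j} (blockOf-x a b)
  isEx-x : ∀ {j} → 1 ≤ j → j ≤ n → isEx P j ≡ true
  isEx-x {j} a b = ex-of {j} (blockOf-x a b)
  lv-t : ∀ {j} → 2 ≤ j → j ≤ n → lv P (n + j) ≡ 3
  lv-t {j} a b = lv-of {n + j} (blockOf-t a b)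
  isEx-t : ∀ {j} → 2 ≤ j → j ≤ n → isEx P (n + j) ≡ true
  isEx-t {j} a b = ex-of {n + j} (blockOf-t a b)
  lv-z : lv P 0 ≡ 2
  lv-z = lv-of {0} blockOf-z
  isUniv-z : isUniv P 0 ≡ true
  isUniv-z = un-of {0} blockOf-z

  x∈vars : ∀ {j} → 1 ≤ j → j ≤ n → j ∈ vars P
  x∈vars a b = ∈-++⁺ˡ (x∈xVars a b)

  lemX3 : ∀ {i n} → i < n ∸ 1 → 2 + i ≤ n
  lemX3 {i} {suc n} h = s≤s h

  1≤lv : ∀ {y} → y ∈ vars P → 1 ≤ lv P y
  1≤lv {y} m with ∈-++⁻ xVars m
  ... | inj₁ m1 with ∈-applyUpTo⁻ (λ j → QParityVars.x n (suc j)) m1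
  ... | i , i<n , refl rewrite lv-x {suc i} z<s i<n = ≤-refl
  1≤lv {y} m | inj₂ m2 with ∈-++⁻ (0 ∷ []) m2
  ... | inj₁ (here refl) rewrite lv-z = z<s
  ... | inj₂ m3 with ∈-++⁻ tVars m3
  ... | inj₂ ()
  ... | inj₁ m4 with ∈-applyUpTo⁻ (λ j → QParityVars.t n (2 + j)) m4
  ... | i , i<n , refl rewrite lv-t {2 + i} sz<ss (lemX3 i<n) = z<s

  -- p_j, and its value prevParity f j under x_i := f i; parity f j is the value t_j is forced to.
  prevParity : (ℕ → Bool) → ℕ → Bool
  parity : (ℕ → Bool) → ℕ → Bool
  prevParity f zero = false
  prevParity f (suc zero) = false
  prevParity f (suc (suc zero)) = f 1
  prevParity f (suc (suc (suc k))) = parity f (suc (suc k))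
  parity f j = f j xor prevParity f j

  prevVar : ℕ → ℕ
  prevVar (suc (suc zero)) = 1
  prevVar (suc (suc (suc k))) = n + suc (suc k)
  prevVar _ = 0

  InState : (ℕ → Bool) → ℕ → ℕ → Lit → Set
  InState f a b ℓ = (∃[ j ] (1 ≤ j × j ≤ a × ℓ ≡ (j , f j))) ⊎ (∃[ j ] (2 ≤ j × j ≤ b × ℓ ≡ (n + j , parity f j)))

  record State (f : ℕ → Bool) (a b : ℕ) (σ : List Lit) : Set where
    field
      contains : ∀ {ℓ} → InState f a b ℓ → ℓ ∈ σ
      onlyContains : ∀ {ℓ} → ℓ ∈ σ → InState f a b ℓ
  open State public

  x-unassigned : ∀ {f a b σ} → State f a b σ → a ≤ n → ∀ {j} → a < j → j ≤ n → Unassigned σ j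
  x-unassigned c an lt jn v m with onlyContains c m
  ... | inj₁ (j' , _ , le , refl) = <⇒≱ lt le
  ... | inj₂ (j' , h2 , _ , eq) = x≢t jn (≤-trans z<s h2) (cong proj₁ eq)

  t-unassigned : ∀ {f a b σ} → State f a b σ → a ≤ n → ∀ {j} → b < j → Unassigned σ (n + j)
  t-unassigned c an {j} lt v m with onlyContains c m
  ... | inj₁ (j' , _ , le , eq) = x≢t (≤-trans le an) (≤-trans z<s lt) (sym (cong proj₁ eq))
  ... | inj₂ (j' , h2 , le , eq) = <⇒≱ lt (subst (_≤ _) (sym (+-cancelˡ-≡ n j j' (cong proj₁ eq))) le)

  z-unassigned : ∀ {f a b σ} → State f a b σ → Unassigned σ 0
  z-unassigned c v m with onlyContains c m
  ... | inj₁ (j' , h1 , _ , eq) = <⇒≱ h1 (subst (_≤ 0) (cong proj₁ eq) ≤-refl)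
  ... | inj₂ (j' , h2 , _ , eq) = x≢t z≤n (≤-trans z<s h2) (cong proj₁ eq)

  State-consistent : ∀ {f a b σ v c c'} → State f a b σ → a ≤ n → (v , c) ∈ σ → (v , c') ∈ σ → c ≡ c'
  State-consistent {f} cf an m m' with onlyContains cf m | onlyContains cf m'
  ... | inj₁ (j1 , _ , _ , refl) | inj₁ (j2 , _ , _ , refl) = refl
  ... | inj₁ (j1 , _ , l1 , e1) | inj₂ (j2 , h2 , _ , e2) = ⊥-elim
    (x≢t (≤-trans l1 an) (≤-trans z<s h2) (trans (sym (cong proj₁ e1)) (cong proj₁ e2)))
  ... | inj₂ (j2 , h2 , _ , e2) | inj₁ (j1 , _ , l1 , e1) = ⊥-elim
    (x≢t (≤-trans l1 an) (≤-trans z<s h2) (trans (sym (cong proj₁ e1)) (cong proj₁ e2)))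
  ... | inj₂ (j1 , _ , _ , e1) | inj₂ (j2 , _ , _ , e2) with +-cancelˡ-≡ n j1 j2 (trans (sym (cong proj₁ e1)) (cong proj₁ e2))
  ... | refl = trans (cong proj₂ e1) (sym (cong proj₂ e2))

  complement∉ : ∀ {f a b σ ℓ} → State f a b σ → a ≤ n → ℓ ∈ σ → (~ ℓ) ∉ σ
  complement∉ cf an m m' = not-¬ refl (State-consistent cf an m m')

  x-value : ∀ {f a b σ j} → State f a b σ → 1 ≤ j → j ≤ a → (j , f j) ∈ σ
  x-value c h1 h2 = contains c (inj₁ (_ , h1 , h2 , refl))

  t-value : ∀ {f a b σ j} → State f a b σ → 2 ≤ j → j ≤ b → (n + j , parity f j) ∈ σ
  t-value c h1 h2 = contains c (inj₂ (_ , h1 , h2 , refl))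

  prevVar-value : ∀ {f a b σ} → State f a b σ → 1 ≤ a → ∀ j → 2 ≤ j → j ≤ suc b → (prevVar j , prevParity f j) ∈ σ
  prevVar-value c a1 (suc zero) (s≤s ()) _
  prevVar-value c a1 (suc (suc zero)) _ _ = x-value c ≤-refl a1
  prevVar-value c a1 (suc (suc (suc k))) _ le = t-value c sz<ss (≤-pred le)

  State-empty : ∀ {f} → State f 0 0 []
  State-empty = record
    { contains = λ { (inj₁ (_ , 1≤j , j≤0 , _)) → ⊥-elim (<⇒≱ 1≤j j≤0)
                   ; (inj₂ (_ , 2≤j , j≤0 , _)) → ⊥-elim (<⇒≱ (≤-trans z<s 2≤j) j≤0) }
    ; onlyContains = λ ()
    }

  InState-mono : ∀ {f a b a' b' ℓ} → a ≤ a' → b ≤ b' → InState f a b ℓ → InState f a' b' ℓ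
  InState-mono la lb (inj₁ (j , h1 , h2 , e)) = inj₁ (j , h1 , ≤-trans h2 la , e)
  InState-mono la lb (inj₂ (j , h1 , h2 , e)) = inj₂ (j , h1 , ≤-trans h2 lb , e)

  State-assign-x : ∀ {f b σ c} → State f b b σ → f (suc b) ≡ c → State f (suc b) b (σ ++ (suc b , c) ∷ [])
  State-assign-x {f} {b} {σ} {c} cf e = record { contains = ci ; onlyContains = co }
    where
    ci : ∀ {ℓ} → InState f (suc b) b ℓ → ℓ ∈ σ ++ (suc b , c) ∷ []
    ci (inj₁ (j , h1 , h2 , eq)) with m≤n⇒m<n∨m≡n h2
    ... | inj₁ lt = ∈-++⁺ˡ (contains cf (inj₁ (j , h1 , ≤-pred lt , eq)))
    ... | inj₂ refl = ∈-++⁺ʳ σ (here (trans eq (cong (suc b ,_) e)))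
    ci (inj₂ x) = ∈-++⁺ˡ (contains cf (inj₂ x))
    co : ∀ {ℓ} → ℓ ∈ σ ++ (suc b , c) ∷ [] → InState f (suc b) b ℓ
    co m with ∈-++⁻ σ m
    ... | inj₁ m' = InState-mono (n≤1+n b) ≤-refl (onlyContains cf m')
    ... | inj₂ (here eq) = inj₁ (suc b , z<s , ≤-refl , trans eq (cong (suc b ,_) (sym e)))

  State-assign-t : ∀ {f b σ c} → State f (suc b) b σ → 1 ≤ b → parity f (suc b) ≡ c → State f (suc b) (suc b) (σ ++ (n + suc b , c) ∷ [])
  State-assign-t {f} {b} {σ} {c} cf b1 e = record { contains = ci ; onlyContains = co }
    where
    ci : ∀ {ℓ} → InState f (suc b) (suc b) ℓ → ℓ ∈ σ ++ (n + suc b , c) ∷ []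
    ci (inj₁ x) = ∈-++⁺ˡ (contains cf (inj₁ x))
    ci (inj₂ (j , h1 , h2 , eq)) with m≤n⇒m<n∨m≡n h2
    ... | inj₁ lt = ∈-++⁺ˡ (contains cf (inj₂ (j , h1 , ≤-pred lt , eq)))
    ... | inj₂ refl = ∈-++⁺ʳ σ (here (trans eq (cong (n + suc b ,_) e)))
    co : ∀ {ℓ} → ℓ ∈ σ ++ (n + suc b , c) ∷ [] → InState f (suc b) (suc b) ℓ
    co m with ∈-++⁻ σ m
    ... | inj₁ m' = InState-mono ≤-refl (n≤1+n b) (onlyContains cf m')
    ... | inj₂ (here eq) = inj₂ (suc b , s≤s b1 , ≤-refl , trans eq (cong (n + suc b ,_) (sym e)))

  State-b0⇒b1 : ∀ {f a σ} → State f a 0 σ → State f a 1 σ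
  State-b0⇒b1 {f} {a} {σ} cf = record { contains = ci ; onlyContains = λ m → InState-mono ≤-refl z≤n (onlyContains cf m) }
    where
    ci : ∀ {ℓ} → InState f a 1 ℓ → ℓ ∈ σ
    ci (inj₁ x) = contains cf (inj₁ x)
    ci (inj₂ (j , h1 , h2 , _)) = ⊥-elim (<⇒≱ h1 h2)

  prevParity-cong : ∀ {f g a} → (∀ {j} → 1 ≤ j → j ≤ a → f j ≡ g j) → ∀ j → j ≤ a → prevParity f j ≡ prevParity g j
  parity-cong : ∀ {f g a} → (∀ {j} → 1 ≤ j → j ≤ a → f j ≡ g j) → ∀ j → 1 ≤ j → j ≤ a → parity f j ≡ parity g j
  prevParity-cong ag zero _ = refl
  prevParity-cong ag (suc zero) _ = refl
  prevParity-cong ag (suc (suc zero)) le = ag z<s (≤-trans (n≤1+n 1) le)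
  prevParity-cong ag (suc (suc (suc k))) le = parity-cong ag (suc (suc k)) z<s (≤-trans (n≤1+n _) le)
  parity-cong ag j h1 h2 = cong₂ _xor_ (ag h1 h2) (prevParity-cong ag j h2)

  State-cong : ∀ {f g a b σ} → State f a b σ → b ≤ a → (∀ {j} → 1 ≤ j → j ≤ a → f j ≡ g j) → State g a b σ
  State-cong {f} {g} {a} {b} {σ} cf ba ag = record { contains = ci ; onlyContains = co }
    where
    ci : ∀ {ℓ} → InState g a b ℓ → ℓ ∈ σ
    ci (inj₁ (j , h1 , h2 , eq)) = contains cf (inj₁ (j , h1 , h2 , trans eq (cong (j ,_) (sym (ag h1 h2)))))
    ci (inj₂ (j , h1 , h2 , eq)) = contains cf
      (inj₂ (j , h1 , h2 , trans eq (cong (n + j ,_) (sym (parity-cong ag j (≤-trans z<s h1) (≤-trans h2 ba))))))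
    co : ∀ {ℓ} → ℓ ∈ σ → InState g a b ℓ
    co m with onlyContains cf m
    ... | inj₁ (j , h1 , h2 , eq) = inj₁ (j , h1 , h2 , trans eq (cong (j ,_) (ag h1 h2)))
    ... | inj₂ (j , h1 , h2 , eq) = inj₂ (j , h1 , h2 , trans eq (cong (n + j ,_) (parity-cong ag j (≤-trans z<s h1) (≤-trans h2 ba))))

  allFalse : ℕ → Bool
  allFalse _ = false

  prevParity-allFalse : ∀ j → prevParity allFalse j ≡ false
  prevParity-allFalse zero = refl
  prevParity-allFalse (suc zero) = refl
  prevParity-allFalse (suc (suc zero)) = refl
  prevParity-allFalse (suc (suc (suc k))) = prevParity-allFalse (suc (suc k))

  parity-allFalse : ∀ j → parity allFalse j ≡ false
  parity-allFalse j = prevParity-allFalse j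

  open Reduction P

  -- (x_j)^sx ∨ (p_j)^sp ∨ (t_j)^(sx xor sp), with the literals in the order of QParityMatrix so
  -- that membership in the matrix holds by refl.
  parityClause : ℕ → Bool → Bool → Clause
  parityClause (suc (suc zero)) sx sp = (1 , sp) ∷ (2 , sx) ∷ (n + 2 , sx xor sp) ∷ []
  parityClause (suc (suc (suc k))) sx sp =
    (3 + k , sx) ∷ (n + (2 + k) , sp) ∷ (n + (3 + k) , sx xor sp) ∷ []
  parityClause _ _ _ = []

  parityBlock : ℕ → List Clause
  parityBlock i = parityClause i true true ∷ parityClause i true false ∷ parityClause i false true ∷ parityClause i false false ∷ []

  finalPos finalNeg : Clause
  finalPos = (n + n , true) ∷ (0 , true) ∷ []
  finalNeg = (n + n , false) ∷ (0 , false) ∷ []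

  Matrix : List Clause
  Matrix = QParityMatrix n

  zeroStep : ℕ → Trail
  zeroStep m = dec (suc m , false) ∷ prop (n + suc m , false) (parityClause (suc m) true true) ∷ []

  zeros : ℕ → Trail
  zeros zero = []
  zeros (suc zero) = dec (1 , false) ∷ []
  zeros (suc (suc k)) = zeros (suc k) ++ zeroStep (suc k)

  State-zeros : ∀ m → State allFalse m m (assigned (zeros m))
  State-zeros zero = State-empty
  State-zeros (suc zero) = State-b0⇒b1 (State-assign-x State-empty refl)
  State-zeros (suc (suc k)) = subst (State allFalse (suc (suc k)) (suc (suc k))) eq
    (State-assign-t (State-assign-x (State-zeros (suc k)) refl) z<s (parity-allFalse (suc (suc k))))
    where
    eq : (assigned (zeros (suc k)) ++ (suc (suc k) , false) ∷ []) ++ (n + suc (suc k) , false) ∷ [] ≡ assigned (zeros (suc (suc k)))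
    eq = trans (++-assoc (assigned (zeros (suc k))) _ _) (sym (assigned-++ (zeros (suc k)) _))

  ∈-parityClause⁻ : ∀ {j sx sp ℓ} → ℓ ∈ parityClause j sx sp → ℓ ≡ (j , sx) ⊎ ℓ ≡ (prevVar j , sp) ⊎ ℓ ≡ (n + j , sx xor sp)
  ∈-parityClause⁻ {suc (suc zero)} (here refl) = inj₂ (inj₁ refl)
  ∈-parityClause⁻ {suc (suc zero)} (there (here refl)) = inj₁ refl
  ∈-parityClause⁻ {suc (suc zero)} (there (there (here refl))) = inj₂ (inj₂ refl)
  ∈-parityClause⁻ {suc (suc (suc k))} (here refl) = inj₁ refl
  ∈-parityClause⁻ {suc (suc (suc k))} (there (here refl)) = inj₂ (inj₁ refl)
  ∈-parityClause⁻ {suc (suc (suc k))} (there (there (here refl))) = inj₂ (inj₂ refl)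

  x∈parityClause : ∀ {j sx sp} → 2 ≤ j → (j , sx) ∈ parityClause j sx sp
  x∈parityClause {suc zero} (s≤s ())
  x∈parityClause {suc (suc zero)} _ = there (here refl)
  x∈parityClause {suc (suc (suc k))} _ = here refl

  prevVar∈parityClause : ∀ {j sx sp} → 2 ≤ j → (prevVar j , sp) ∈ parityClause j sx sp
  prevVar∈parityClause {suc zero} (s≤s ())
  prevVar∈parityClause {suc (suc zero)} _ = here refl
  prevVar∈parityClause {suc (suc (suc k))} _ = there (here refl)

  t∈parityClause : ∀ {j sx sp} → 2 ≤ j → (n + j , sx xor sp) ∈ parityClause j sx sp
  t∈parityClause {suc zero} (s≤s ())
  t∈parityClause {suc (suc zero)} _ = there (there (here refl))
  t∈parityClause {suc (suc (suc k))} _ = there (there (here refl))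

  isEx-prevVar : ∀ {j} → 2 ≤ j → j ≤ n → isEx P (prevVar j) ≡ true
  isEx-prevVar {suc zero} (s≤s ()) _
  isEx-prevVar {suc (suc zero)} _ _ = isEx-x z<s (≤-trans z<s 2≤n)
  isEx-prevVar {suc (suc (suc k))} _ le = isEx-t sz<ss (≤-trans (n≤1+n _) le)

  ∈-Matrix⁻ : ∀ {C} → C ∈ Matrix → (∃[ j ] ∃[ sx ] ∃[ sp ] (2 ≤ j × j ≤ n × C ≡ parityClause j sx sp)) ⊎ C ≡ finalPos ⊎ C ≡ finalNeg
  ∈-Matrix⁻ (here refl) = inj₁ (2 , _ , _ , ≤-refl , 2≤n , refl)
  ∈-Matrix⁻ (there (here refl)) = inj₁ (2 , _ , _ , ≤-refl , 2≤n , refl)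
  ∈-Matrix⁻ (there (there (here refl))) = inj₁ (2 , _ , _ , ≤-refl , 2≤n , refl)
  ∈-Matrix⁻ (there (there (there (here refl)))) = inj₁ (2 , _ , _ , ≤-refl , 2≤n , refl)
  ∈-Matrix⁻ (there (there (there (there m)))) with ∈-++⁻ (concat (applyUpTo (λ j → parityBlock (3 + j)) (n ∸ 2))) m
  ... | inj₂ (here refl) = inj₂ (inj₁ refl)
  ... | inj₂ (there (here refl)) = inj₂ (inj₂ refl)
  ... | inj₁ m' with ∈-concat⁻′ (applyUpTo (λ j → parityBlock (3 + j)) (n ∸ 2)) m'
  ... | xs , mx , mxs with ∈-applyUpTo⁻ (λ j → parityBlock (3 + j)) mxs
  ... | i , i<n , refl with blkc mx
    where
    blkc : ∀ {C} → C ∈ parityBlock (3 + i) → ∃[ sx ] ∃[ sp ] (C ≡ parityClause (3 + i) sx sp)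
    blkc (here refl) = _ , _ , refl
    blkc (there (here refl)) = _ , _ , refl
    blkc (there (there (here refl))) = _ , _ , refl
    blkc (there (there (there (here refl)))) = _ , _ , refl
  ... | sx , sp , eq = inj₁ (3 + i , sx , sp , sz<ss , lem i<n , eq)
    where
    lem : ∀ {i m} → i < m ∸ 2 → 3 + i ≤ m
    lem {i} {suc (suc m)} h = s≤s (s≤s h)

  parityClause-hit : ∀ sx sp a c → sx ≡ a ⊎ sp ≡ c ⊎ (sx xor sp) ≡ (a xor c)
  parityClause-hit true sp true c = inj₁ refl
  parityClause-hit false sp false c = inj₁ refl
  parityClause-hit true true false true = inj₂ (inj₁ refl)
  parityClause-hit true false false false = inj₂ (inj₁ refl)
  parityClause-hit false true true true = inj₂ (inj₁ refl)
  parityClause-hit false false true false = inj₂ (inj₁ refl)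
  parityClause-hit true true false false = inj₂ (inj₂ refl)
  parityClause-hit true false false true = inj₂ (inj₂ refl)
  parityClause-hit false true true false = inj₂ (inj₂ refl)
  parityClause-hit false false true true = inj₂ (inj₂ refl)

  2≤⇒1≤ : ∀ {j} → 2 ≤ j → 1 ≤ j
  2≤⇒1≤ h = ≤-trans z<s h

  parityClause-satisfied : ∀ {f a b σ j sx sp} → State f a b σ → b ≤ a → 2 ≤ j → j ≤ b → NotUnit σ (parityClause j sx sp)
  parityClause-satisfied {f} {a} {b} {σ} {j} {sx} {sp} c ba h jb with parityClause-hit sx sp (f j) (prevParity f j)
  ... | inj₁ refl = satisfied⇒NotUnit σ _ (x∈parityClause h) (x-value c (2≤⇒1≤ h) (≤-trans jb ba))
  ... | inj₂ (inj₁ refl) = satisfied⇒NotUnit σ _ (prevVar∈parityClause h)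
    (prevVar-value c (≤-trans (2≤⇒1≤ h) (≤-trans jb ba)) j h (≤-trans jb (n≤1+n b)))
  ... | inj₂ (inj₂ e) = satisfied⇒NotUnit σ _ (t∈parityClause h) (subst (λ t → (n + j , t) ∈ σ) (sym e) (t-value c h jb))

  parityClause-¬conflict : ∀ {f a b σ j sx sp} → State f a b σ → a ≤ n → b < j → j ≤ n → 2 ≤ j → ¬ UnitFor P σ (parityClause j sx sp) nothing
  parityClause-¬conflict {σ = σ} {j} c an lt jn h = survivor⇒¬conflict σ _ (t∈parityClause h) (t-unassigned c an lt)
    (inj₁ (isEx⇒¬isUniv P (n + (j)) (isEx-t {j} h jn)))

  parityClause-open : ∀ {f a σ j sx sp} → State f a a σ → a ≤ n → a < j → j ≤ n → 2 ≤ j → NotUnit σ (parityClause j sx sp)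
  parityClause-open {σ = σ} {j} c an lt jn h =
    survivors⇒NotUnit σ _ (x∈parityClause h) (t∈parityClause h) (λ e → x≢t jn (2≤⇒1≤ h) (cong proj₁ e)) (x-unassigned c an lt jn)
      (t-unassigned c an lt)
      (inj₁ (isEx⇒¬isUniv P (j) (isEx-x {j} (2≤⇒1≤ h) jn))) (inj₁ (isEx⇒¬isUniv P (n + (j)) (isEx-t {j} h jn)))

  lv-z≤lv-t : ∀ {k} → 2 ≤ k → k ≤ n → lv P 0 ≤ lv P (n + k)
  lv-z≤lv-t h1 h2 = subst₂ _≤_ (sym lv-z) (sym (lv-t h1 h2)) sz<ss

  finalClause-NotUnit : ∀ {f a b σ s} → State f a b σ → a ≤ n → b < n → NotUnit σ ((n + n , s) ∷ (0 , s) ∷ [])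
  finalClause-NotUnit {σ = σ} c an bn =
    survivors⇒NotUnit σ _ (here refl) (there (here refl)) (λ e → x≢t z≤n (≤-trans z<s 2≤n) (sym (cong proj₁ e)))
      (t-unassigned c an bn) (z-unassigned c) (inj₁ (isEx⇒¬isUniv P (n + (n)) (isEx-t {n} 2≤n ≤-refl)))
      (inj₂ (_ , here refl , t-unassigned c an bn , isEx-t {n} 2≤n ≤-refl , lv-z≤lv-t 2≤n ≤-refl))

  Matrix-NotUnit : ∀ {f a σ} → State f a a σ → a < n → ∀ {C} → C ∈ Matrix → NotUnit σ C
  Matrix-NotUnit {a = a} c an m with ∈-Matrix⁻ m
  ... | inj₂ (inj₁ refl) = finalClause-NotUnit c (<⇒≤ an) an
  ... | inj₂ (inj₂ refl) = finalClause-NotUnit c (<⇒≤ an) an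
  ... | inj₁ (j , sx , sp , h , jn , refl) with j ≤? a
  ... | yes ja = parityClause-satisfied c ≤-refl h ja
  ... | no ja = parityClause-open c (<⇒≤ an) (≰⇒> ja) jn h

  Matrix-¬conflict : ∀ {f a b σ} → State f a b σ → a ≤ n → b < n → b ≤ a → ∀ {C} → C ∈ Matrix → ¬ UnitFor P σ C nothing
  Matrix-¬conflict {b = b} c an bn ba m with ∈-Matrix⁻ m
  ... | inj₂ (inj₁ refl) = finalClause-NotUnit c an bn nothing
  ... | inj₂ (inj₂ refl) = finalClause-NotUnit c an bn nothing
  ... | inj₁ (j , sx , sp , h , jn , refl) with j ≤? b
  ... | yes jb = parityClause-satisfied c ba h jb nothing
  ... | no jb = parityClause-¬conflict c an (≰⇒> jb) jn h

  Within : Clause → List Lit → Set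
  Within C E = ∀ {ℓ} → ℓ ∈ C → var ℓ ≡ 0 ⊎ ℓ ∈ E

  HasZ : Clause → Set
  HasZ C = ∃[ ℓ ] (ℓ ∈ C × var ℓ ≡ 0)

  TZ : ℕ → Bool → Clause → Set
  TZ k s C = Within C ((n + k , s) ∷ []) × (n + k , s) ∈ C × HasZ C

  XP : ℕ → Bool → Clause → Set
  XP j s C = Within C ((j , true) ∷ (prevVar j , s) ∷ []) × (j , true) ∈ C × (prevVar j , s) ∈ C

  TZ-NotUnit : ∀ {f a b σ k s C} → State f a b σ → a ≤ n → 2 ≤ k → k ≤ n → b < k → TZ k s C → NotUnit σ C
  TZ-NotUnit {σ = σ} {k} {s} {C} c an h1 h2 bk (_ , m1 , (ℓz , mz , vz)) =
    survivors⇒NotUnit σ C m1 mz (λ e → x≢t z≤n (2≤⇒1≤ h1) (sym (trans (cong proj₁ e) vz)))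
      (t-unassigned c an bk) (subst (Unassigned σ) (sym vz) (z-unassigned c)) (inj₁ (isEx⇒¬isUniv P (n + (k)) (isEx-t {k} h1 h2)))
      (inj₂ (_ , m1 , t-unassigned c an bk , isEx-t {k} h1 h2 , subst (λ v → lv P v ≤ lv P (n + k)) (sym vz) (lv-z≤lv-t h1 h2)))

  TZ-finalPos : TZ n true finalPos
  TZ-finalPos = within , here refl , (0 , true) , there (here refl) , refl
    where
    within : Within finalPos ((n + n , true) ∷ [])
    within (here refl) = inj₂ (here refl)
    within (there (here refl)) = inj₁ refl

  TZ-finalNeg : TZ n false finalNeg
  TZ-finalNeg = within , here refl , (0 , false) , there (here refl) , refl
    where
    within : Within finalNeg ((n + n , false) ∷ [])
    within (here refl) = inj₂ (here refl)
    within (there (here refl)) = inj₁ refl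

  TZ-satisfied : ∀ {σ k s C} → (n + k , s) ∈ σ → TZ k s C → NotUnit σ C
  TZ-satisfied {σ} {C = C} m (_ , m1 , _) = satisfied⇒NotUnit σ C m1 m

  XP-NotUnit : ∀ {f a b σ k s C} → State f a b σ → a ≤ n → 3 + k ≤ n → a < 3 + k → b < 2 + k → XP (3 + k) s C → NotUnit σ C
  XP-NotUnit {σ = σ} {k} {C = C} c an jn ak bk (_ , m1 , m2) =
    survivors⇒NotUnit σ C m1 m2 (λ e → x≢t jn z<s (cong proj₁ e)) (x-unassigned c an ak jn) (t-unassigned c an bk)
      (inj₁ (isEx⇒¬isUniv P (3 + k) (isEx-x {3 + k} z<s jn))) (inj₁ (isEx⇒¬isUniv P (n + (2 + k)) (isEx-t {2 + k} sz<ss (≤-trans (n≤1+n _) jn))))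

  XP-¬conflict : ∀ {f a b σ j s C} → State f a b σ → a ≤ n → j ≤ n → a < j → XP j s C → ¬ UnitFor P σ C nothing
  XP-¬conflict {σ = σ} {j} {C = C} c an jn aj (_ , m1 , _) =
    survivor⇒¬conflict σ C m1 (x-unassigned c an aj jn) (inj₁ (isEx⇒¬isUniv P (j) (isEx-x {j} (≤-trans z<s aj) jn)))

  XP-satisfied-x : ∀ {σ j s C} → (j , true) ∈ σ → XP j s C → NotUnit σ C
  XP-satisfied-x {σ} {C = C} m (_ , m1 , _) = satisfied⇒NotUnit σ C m1 m

  XP-satisfied-p : ∀ {σ j s C} → (prevVar j , s) ∈ σ → XP j s C → NotUnit σ C
  XP-satisfied-p {σ} {C = C} m (_ , _ , m2) = satisfied⇒NotUnit σ C m2 m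

  Learnt : ℕ → Clause → Set
  Learnt i C = (∃[ k ] ∃[ s ] (i ≤ k × k ≤ n × TZ k s C)) ⊎ (∃[ j ] ∃[ s ] (suc i ≤ j × j ≤ n × XP j s C))

  Learnt-suc : ∀ {i C} → Learnt (suc i) C → Learnt i C
  Learnt-suc (inj₁ (k , s , a , b , c)) = inj₁ (k , s , ≤-trans (n≤1+n _) a , b , c)
  Learnt-suc (inj₂ (j , s , a , b , c)) = inj₂ (j , s , ≤-trans (n≤1+n _) a , b , c)

  Learnt-NotUnit : ∀ {i f a b σ C} → 2 ≤ i → State f a b σ → a ≤ n → b < i → a ≤ i → Learnt i C → NotUnit σ C
  Learnt-NotUnit i2 c an bi ai (inj₁ (k , s , ik , kn , kt)) = TZ-NotUnit c an (≤-trans i2 ik) kn (<-≤-trans bi ik) kt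
  Learnt-NotUnit {i} i2 c an bi ai (inj₂ (j , s , ij , jn , kl)) = go j ij jn kl
    where
    go : ∀ j → suc i ≤ j → j ≤ n → XP j s _ → NotUnit _ _
    go (suc (suc (suc k))) ij jn kl = XP-NotUnit c an jn (≤-<-trans ai ij) (<-≤-trans bi (≤-pred ij)) kl
    go zero () _ _
    go (suc zero) ij _ _ = ⊥-elim (<⇒≱ (≤-trans i2 (≤-pred ij)) z≤n)
    go (suc (suc zero)) ij _ _ = ⊥-elim (<⇒≱ (≤-trans (s≤s i2) ij) ≤-refl)

  Invariant : ℕ → List Clause → Set
  Invariant i S = ∀ {C} → C ∈ S → C ∈ Matrix ⊎ Learnt i C

  Invariant-Matrix : Invariant n Matrix
  Invariant-Matrix = inj₁

  Invariant-NotUnit : ∀ {i S f a σ} → 2 ≤ i → Invariant i S → State f a a σ → a < n → a < i → ∀ {C} → C ∈ S → NotUnit σ C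
  Invariant-NotUnit i2 inv c an ai m with inv m
  ... | inj₁ mm = Matrix-NotUnit c an mm
  ... | inj₂ o = Learnt-NotUnit i2 c (<⇒≤ an) ai (<⇒≤ ai) o

  Invariant-¬conflict : ∀ {i S f a b σ} → 2 ≤ i → Invariant i S → State f a b σ → a ≤ n → b < n → b ≤ a → b < i → a ≤ i →
          ∀ {C} → C ∈ S → ¬ UnitFor P σ C nothing
  Invariant-¬conflict i2 inv c an bn ba bi ai m with inv m
  ... | inj₁ mm = Matrix-¬conflict c an bn ba mm
  ... | inj₂ o = Learnt-NotUnit i2 c an bi ai o nothing

  decision-ok : ∀ {S} pre {f a b} j c → State f a b (assigned pre) → a ≤ n → a < j → j ≤ n → EntryOKBefore P S pre (dec (j , c))
  decision-ok pre j c cf an aj jn =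
    x∈vars (≤-trans z<s aj) jn , Unassigned⇒∉vars (x-unassigned cf an aj jn) ,
    λ y my _ → subst (_≤ lv P y) (sym (lv-x {j} (≤-trans z<s aj) jn)) (1≤lv my)

  propagation-ok : ∀ {S} pre p A → A ∈ S → Unassigned (assigned pre) (var p) → UnitFor P (assigned pre) A (just p) → EntryOKBefore P S pre (prop p A)
  propagation-ok pre p A mA u un = mA , Unassigned⇒∉vars u , un

  parityClause-unit : ∀ {f a b σ j sx sp} → State f a b σ → a ≤ n → 2 ≤ j → j ≤ n → b < j →
          (j , not sx) ∈ σ → (prevVar j , not sp) ∈ σ → UnitFor P σ (parityClause j sx sp) (just (n + j , sx xor sp))
  parityClause-unit {σ = σ} {j} {sx} {sp} cf an h jn bj mx mp =
    unit-intro σ _ _ (t∈parityClause h) (isEx-t {j} h jn) (t-unassigned cf an bj _) cond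
    where
    cond : ∀ {ℓ} → ℓ ∈ parityClause j sx sp → UnitCond σ (n + j , sx xor sp) ℓ
    cond m with ∈-parityClause⁻ m
    ... | inj₁ refl = (λ m' → complement∉ cf an m' mx) , inj₂ (inj₁ mx)
    ... | inj₂ (inj₁ refl) = (λ m' → complement∉ cf an m' mp) , inj₂ (inj₁ mp)
    ... | inj₂ (inj₂ refl) = t-unassigned cf an bj _ , inj₁ refl

  lv-x<lv-z : ∀ {j} → 1 ≤ j → j ≤ n → lv P j < lv P 0
  lv-x<lv-z {j} h1 h2 = subst₂ _<_ (sym (lv-x {j} h1 h2)) (sym lv-z) sz<ss

  x-unit : ∀ {f a b σ j C} → State f a b σ → a ≤ n → 1 ≤ j → j ≤ n → a < j → (j , true) ∈ C →
          (∀ {ℓ} → ℓ ∈ C → var ℓ ≡ 0 ⊎ ℓ ≡ (j , true) ⊎ (~ ℓ) ∈ σ) → UnitFor P σ C (just (j , true))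
  x-unit {σ = σ} {j} {C} cf an h1 jn aj mj hC = unit-intro σ C _ mj (isEx-x {j} h1 jn) (x-unassigned cf an aj jn _) cond
    where
    cond : ∀ {ℓ} → ℓ ∈ C → UnitCond σ (j , true) ℓ
    cond {ℓ} m with hC m
    ... | inj₁ v0 = subst (Unassigned σ) (sym v0) (z-unassigned cf) (proj₂ ℓ) ,
                    inj₂ (inj₂ (subst (λ v → isUniv P v ≡ true) (sym v0) isUniv-z , subst (λ v → lv P j < lv P v) (sym v0) (lv-x<lv-z h1 jn)))
    ... | inj₂ (inj₁ refl) = x-unassigned cf an aj jn _ , inj₁ refl
    ... | inj₂ (inj₂ q) = (λ m' → complement∉ cf an q (subst (_∈ σ) (sym (~-involutive ℓ)) m')) , inj₂ (inj₁ q)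

  conflict-on-z : ∀ {f a b σ C} → State f a b σ → a ≤ n → (∀ {ℓ} → ℓ ∈ C → var ℓ ≡ 0 ⊎ (~ ℓ) ∈ σ) → UnitFor P σ C nothing
  conflict-on-z {σ = σ} {C} cf an hC = conflict-intro σ C cond
    where
    cond : ∀ {ℓ} → ℓ ∈ C → ℓ ∉ σ × ((~ ℓ) ∈ σ ⊎ isUniv P (var ℓ) ≡ true)
    cond {ℓ} m with hC m
    ... | inj₁ v0 = subst (Unassigned σ) (sym v0) (z-unassigned cf) (proj₂ ℓ) , inj₂ (subst (λ v → isUniv P v ≡ true) (sym v0) isUniv-z)
    ... | inj₂ q = (λ m' → complement∉ cf an q (subst (_∈ σ) (sym (~-involutive ℓ)) m')) , inj₁ q

  ⊇Matrix : List Clause → Set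
  ⊇Matrix S = ∀ {C} → C ∈ Matrix → C ∈ S

  State-∷ʳ : ∀ {f a b} pre e → State f a b (assigned pre ++ assigned (e ∷ [])) → State f a b (assigned (pre ++ e ∷ []))
  State-∷ʳ {f} {a} {b} pre e c = subst (State f a b) (sym (assigned-++ pre (e ∷ []))) c

  oneAt : ℕ → ℕ → Bool
  oneAt m j = j ≡ᵇ suc m

  onesAt : ℕ → ℕ → Bool
  onesAt m j = oneAt m j ∨ (j ≡ᵇ suc (suc m))

  allFalse≗oneAt : ∀ m {j} → 1 ≤ j → j ≤ m → allFalse j ≡ oneAt m j
  allFalse≗oneAt m _ le = sym (<⇒≡ᵇ-false (s≤s le))

  oneAt≗onesAt : ∀ m {j} → 1 ≤ j → j ≤ suc m → oneAt m j ≡ onesAt m j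
  oneAt≗onesAt m {j} _ le = sym (trans (cong (oneAt m j ∨_) (<⇒≡ᵇ-false (s≤s le))) (∨-identityʳ _))

  prevParity-cong-suc : ∀ {f g} a → (∀ {j} → 1 ≤ j → j ≤ a → f j ≡ g j) → prevParity f (suc a) ≡ prevParity g (suc a)
  prevParity-cong-suc zero ag = refl
  prevParity-cong-suc (suc zero) ag = ag ≤-refl ≤-refl
  prevParity-cong-suc (suc (suc k)) ag = parity-cong ag (suc (suc k)) z<s ≤-refl

  prevParity-oneAt : ∀ m → prevParity (oneAt m) (suc m) ≡ false
  prevParity-oneAt m = trans (sym (prevParity-cong-suc m (allFalse≗oneAt m))) (prevParity-allFalse (suc m))

  oneAt-self : ∀ m → oneAt m (suc m) ≡ true
  oneAt-self m = ≡ᵇ-refl m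

  parity-oneAt : ∀ m → parity (oneAt m) (suc m) ≡ true
  parity-oneAt m rewrite oneAt-self m | prevParity-oneAt m = refl

  assignedZeros : ℕ → List Lit
  assignedZeros m = assigned (zeros m)

  State-zeros-x0 : ∀ m → State allFalse (suc m) m (assignedZeros m ++ (suc m , false) ∷ [])
  State-zeros-x0 m = State-assign-x (State-zeros m) refl

  State-zeros-x1 : ∀ m → State (oneAt m) (suc m) m (assignedZeros m ++ (suc m , true) ∷ [])
  State-zeros-x1 m = State-assign-x (State-cong (State-zeros m) ≤-refl (allFalse≗oneAt m)) (oneAt-self m)

  State-zeros-x1t : ∀ m → 1 ≤ m → State (oneAt m) (suc m) (suc m) ((assignedZeros m ++ (suc m , true) ∷ []) ++ (n + suc m , true) ∷ [])
  State-zeros-x1t m h = State-assign-t (State-zeros-x1 m) h (parity-oneAt m)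

  ∈-Matrix⁺ : ∀ {j} sx sp → 2 ≤ j → j ≤ n → parityClause j sx sp ∈ Matrix
  ∈-Matrix⁺ {suc zero} _ _ (s≤s ()) _
  ∈-Matrix⁺ {suc (suc zero)} true true _ _ = here refl
  ∈-Matrix⁺ {suc (suc zero)} false true _ _ = there (here refl)
  ∈-Matrix⁺ {suc (suc zero)} true false _ _ = there (there (here refl))
  ∈-Matrix⁺ {suc (suc zero)} false false _ _ = there (there (there (here refl)))
  ∈-Matrix⁺ {suc (suc (suc k))} sx sp _ le =
    there (there (there (there (∈-++⁺ˡ (∈-concat⁺′ (inb sx sp) (∈-applyUpTo⁺ (λ j → parityBlock (3 + j)) (lem le)))))))
    where
    lem : ∀ {k m} → 3 + k ≤ m → k < m ∸ 2
    lem {k} {suc (suc m)} (s≤s (s≤s h)) = h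
    inb : ∀ sx sp → parityClause (3 + k) sx sp ∈ parityBlock (3 + k)
    inb true true = here refl
    inb true false = there (here refl)
    inb false true = there (there (here refl))
    inb false false = there (there (there (here refl)))

  finalPos∈Matrix : finalPos ∈ Matrix
  finalPos∈Matrix = there (there (there (there (∈-++⁺ʳ (concat (applyUpTo (λ j → parityBlock (3 + j)) (n ∸ 2))) (here refl)))))

  finalNeg∈Matrix : finalNeg ∈ Matrix
  finalNeg∈Matrix = there (there (there (there (∈-++⁺ʳ (concat (applyUpTo (λ j → parityBlock (3 + j)) (n ∸ 2))) (there (here refl))))))

  State-zeros-xt : ∀ m → 1 ≤ m → State allFalse (suc m) (suc m) (assigned (zeros m ++ zeroStep m))
  State-zeros-xt m 1≤m =
    subst (State allFalse (suc m) (suc m)) (trans (++-assoc (assignedZeros m) _ _) (sym (assigned-++ (zeros m) _)))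
          (State-assign-t (State-zeros-x0 m) 1≤m (parity-allFalse (suc m)))

  zeros-step-ok : ∀ {S} → ⊇Matrix S → ∀ m → 1 ≤ m → suc m ≤ n → AllAfter (EntryOKBefore P S) (zeros m) (zeroStep m)
  zeros-step-ok {S} mi m 1≤m m<n =
    decision-ok {S} (zeros m) (suc m) false (State-zeros m) (<⇒≤ m<n) ≤-refl m<n ,
    propagation-ok σ (n + suc m , false) (parityClause (suc m) true true)
      (mi (∈-Matrix⁺ true true (s≤s 1≤m) m<n)) (t-unassigned c m<n ≤-refl)
      (parityClause-unit c m<n (s≤s 1≤m) m<n ≤-refl (x-value c z<s ≤-refl) prevVar-false) ,
    tt
    where
    σ = zeros m ++ dec (suc m , false) ∷ []
    c : State allFalse (suc m) m (assigned σ)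
    c = State-∷ʳ (zeros m) _ (State-zeros-x0 m)
    prevVar-false : (prevVar (suc m) , false) ∈ assigned σ
    prevVar-false = subst (λ b → (prevVar (suc m) , b) ∈ assigned σ) (prevParity-allFalse (suc m))
                          (prevVar-value c z<s (suc m) (s≤s 1≤m) ≤-refl)

  zeros-ok : ∀ {S} → ⊇Matrix S → ∀ m → m ≤ n → AllAfter (EntryOKBefore P S) [] (zeros m)
  zeros-ok mi zero _ = tt
  zeros-ok {S} mi (suc zero) 1≤n = decision-ok {S} [] 1 false (State-empty {allFalse}) z≤n z<s 1≤n , tt
  zeros-ok {S} mi (suc (suc k)) m≤n =
    AllAfter-++ (EntryOKBefore P S) [] (zeros (suc k)) _ (zeros-ok mi (suc k) (<⇒≤ m≤n)) (zeros-step-ok mi (suc k) z<s m≤n)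

  zeros-step-natural : ∀ {i S} → 2 ≤ i → Invariant i S → ∀ m → suc m ≤ n → suc m ≤ i →
                       AllAfter (NaturalAt P S) (zeros m) (zeroStep m)
  zeros-step-natural 2≤i inv m m<n m<i =
    natural-decision (zeros m) (suc m , false) (Invariant-NotUnit 2≤i inv (State-zeros m) m<n m<i) ,
    natural-propagation (zeros m ++ dec (suc m , false) ∷ []) (n + suc m , false) (parityClause (suc m) true true)
      (Invariant-¬conflict 2≤i inv (State-∷ʳ (zeros m) _ (State-zeros-x0 m)) m<n m<n (n≤1+n m) m<i m<i) ,
    tt

  zeros-natural : ∀ {i S} → 2 ≤ i → Invariant i S → ∀ m → m ≤ n → m ≤ i → AllAfter (NaturalAt P S) [] (zeros m)
  zeros-natural 2≤i inv zero _ _ = tt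
  zeros-natural 2≤i inv (suc zero) _ _ =
    natural-decision [] (1 , false) (Invariant-NotUnit 2≤i inv (State-empty {allFalse}) (≤-trans z<s 2≤n) (≤-trans z<s 2≤i)) , tt
  zeros-natural {S = S} 2≤i inv (suc (suc k)) m≤n m≤i =
    AllAfter-++ (NaturalAt P S) [] (zeros (suc k)) _ (zeros-natural 2≤i inv (suc k) (<⇒≤ m≤n) (<⇒≤ m≤i))
      (zeros-step-natural 2≤i inv (suc k) m≤n m≤i)

  trailC : ℕ → Clause → Trail
  trailC m Pc = zeros m ++ (zeroStep m ++ confl Pc ∷ [])

  trailC-natural : ∀ {i} {S : List Clause} → 2 ≤ i → Invariant i S → ∀ m Pc → suc m ≤ n → suc m ≤ i →
                   AllAfter (NaturalAt P S) (zeros m) (zeroStep m ++ confl Pc ∷ [])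
  trailC-natural {S = S} 2≤i inv m Pc m<n m<i with d , p , _ ← zeros-step-natural 2≤i inv m m<n m<i =
    d , p , natural-conflict {S} {(zeros m ++ dec (suc m , false) ∷ []) ++ prop (n + suc m , false) (parityClause (suc m) true true) ∷ []} {Pc} , tt

  trailC-ok : ∀ {S m Pc} → ⊇Matrix S → Pc ∈ S → TZ (suc m) true Pc → 1 ≤ m → suc m ≤ n → ConflictTrail P S (trailC m Pc)
  trailC-ok {S} {m} {Pc} mi Pc∈S (within , _ , _) 1≤m m<n =
    subst (ConflictTrail P S) (++-assoc (zeros m) (zeroStep m) (confl Pc ∷ []))
      (conflictTrail P S _ Pc
        (AllAfter-++ (EntryOKBefore P S) [] (zeros m) _ (zeros-ok mi m (<⇒≤ m<n)) (zeros-step-ok mi m 1≤m m<n))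
        Pc∈S (conflict-on-z c m<n falsified))
    where
    c = State-zeros-xt m 1≤m
    σ = assigned (zeros m ++ zeroStep m)
    falsified : ∀ {ℓ} → ℓ ∈ Pc → var ℓ ≡ 0 ⊎ (~ ℓ) ∈ σ
    falsified ℓ∈ with within ℓ∈
    ... | inj₁ onZ = inj₁ onZ
    ... | inj₂ (here refl) = inj₂ (subst (λ b → (n + suc m , b) ∈ σ) (parity-allFalse (suc m)) (t-value c (s≤s 1≤m) ≤-refl))

  learnStep-red-Within : ∀ {Q A p t E} → ~ p ≡ t → t ∈ red P Q → (∀ {ℓ} → ℓ ∈ Q → var ℓ ≡ 0 ⊎ ℓ ≡ t) →
         (∀ {ℓ} → ℓ ∈ A → ℓ ≡ p ⊎ ℓ ∈ E) → Within (learnStep P p A (red P Q)) E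
  learnStep-red-Within {Q} {A} {p} {t} refl mt hQ hA m rewrite learnStep-resolves P p A (red P Q) mt with ∈-resolve⁻ p (red P Q) (red P A) (red-⊆ _ m)
  ... | inj₁ (m1 , ne) with hQ (red-⊆ Q m1)
  ... | inj₁ v0 = inj₁ v0
  ... | inj₂ e = ⊥-elim (ne e)
  learnStep-red-Within {Q} {A} {p} {t} refl mt hQ hA m | inj₂ (m2 , ne) with hA (red-⊆ A m2)
  ... | inj₁ e = ⊥-elim (ne e)
  ... | inj₂ e = inj₂ e

  ∈-learnStep-red⁺ : ∀ {Q A p e} → (~ p) ∈ red P Q → e ∈ A → e ≢ p → isUniv P (var e) ≡ false → e ∈ learnStep P p A (red P Q)
  ∈-learnStep-red⁺ {Q} {A} {p} mt me ne u rewrite learnStep-resolves P p A (red P Q) mt = ∈-red⁺-nonUniv _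
    (∈-resolve⁺ʳ p (red P Q) (red P A) (∈-red⁺-nonUniv A me u) ne) u

  learnStep-Within : ∀ {C L q E} → (~ q) ∈ C → Within C ((~ q) ∷ E) → Within L (q ∷ E) → Within (learnStep P q L C) E
  learnStep-Within {C} {L} {q} mq hC hL m rewrite learnStep-resolves P q L C mq with ∈-resolve⁻ q C (red P L) (red-⊆ _ m)
  ... | inj₁ (m1 , ne) with hC m1
  ... | inj₁ v0 = inj₁ v0
  ... | inj₂ (here e) = ⊥-elim (ne e)
  ... | inj₂ (there e) = inj₂ e
  learnStep-Within {C} {L} {q} mq hC hL m | inj₂ (m2 , ne) with hL (red-⊆ L m2)
  ... | inj₁ v0 = inj₁ v0
  ... | inj₂ (here e) = ⊥-elim (ne e)
  ... | inj₂ (there e) = inj₂ e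

  ∈-learnStep⁺ : ∀ {C L q e} → (~ q) ∈ C → e ∈ C → e ≢ (~ q) → isUniv P (var e) ≡ false → e ∈ learnStep P q L C
  ∈-learnStep⁺ {C} {L} {q} mq me ne u rewrite learnStep-resolves P q L C mq = ∈-red⁺-nonUniv _ (∈-resolve⁺ˡ q C (red P L) me ne) u

  red-onlyZ : ∀ C → (∀ {ℓ} → ℓ ∈ C → var ℓ ≡ 0) → red P C ≡ []
  red-onlyZ C h = no-member⇒≡[] _ el
    where
    el : ∀ {x} → x ∈ red P C → ⊥
    el {x} m with ∈-red-univ⇒blocker C m (subst (λ v → isUniv P v ≡ true) (sym (h (red-⊆ C m))) isUniv-z)
    ... | ℓ' , m' , ex , _ = true≢false (trans (sym ex) (subst (λ v → isEx P v ≡ false) (sym (h m')) (isUniv⇒¬isEx P 0 isUniv-z)))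

  prevVar≢t : ∀ {j} → 2 ≤ j → prevVar j ≢ n + j
  prevVar≢t {suc zero} (s≤s ()) _
  prevVar≢t {suc (suc zero)} _ e = x≢t (≤-trans z<s 2≤n) z<s e
  prevVar≢t {suc (suc (suc k))} _ e with +-cancelˡ-≡ n (suc (suc k)) (suc (suc (suc k))) e
  ... | ()

  prevVar≢x : ∀ {j} → 2 ≤ j → j ≤ n → prevVar j ≢ j
  prevVar≢x {suc zero} (s≤s ()) _
  prevVar≢x {suc (suc zero)} _ _ ()
  prevVar≢x {suc (suc (suc k))} _ le e = x≢t le z<s (sym e)

  lv-prevVar : ∀ {j} → 3 ≤ j → j ≤ n → lv P (prevVar j) ≡ 3
  lv-prevVar {suc (suc (suc k))} _ le = lv-t {suc (suc k)} sz<ss (≤-trans (n≤1+n _) le)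
  lv-prevVar {suc (suc zero)} (s≤s (s≤s ())) _
  lv-prevVar {suc zero} (s≤s ()) _

  ¬isUniv-x : ∀ {j} → 1 ≤ j → j ≤ n → isUniv P j ≡ false
  ¬isUniv-x {j} a b = isEx⇒¬isUniv P j (isEx-x {j} a b)
  ¬isUniv-t : ∀ {j} → 2 ≤ j → j ≤ n → isUniv P (n + j) ≡ false
  ¬isUniv-t {j} a b = isEx⇒¬isUniv P (n + j) (isEx-t {j} a b)
  ¬isUniv-prevVar : ∀ {j} → 2 ≤ j → j ≤ n → isUniv P (prevVar j) ≡ false
  ¬isUniv-prevVar {j} a b = isEx⇒¬isUniv P (prevVar j) (isEx-prevVar a b)

  learnt-XP : ∀ {j Q} sp → 2 ≤ j → j ≤ n → TZ j sp Q → XP j sp (learnStep P (n + j , not sp) (parityClause j true sp) (red P Q))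
  learnt-XP {j} {Q} sp h jn (sub , mt , _) =
    learnStep-red-Within {Q} {parityClause j true sp} {n + j , not sp} {n + j , sp} nn mt' hQ hA ,
    ∈-learnStep-red⁺ {Q} {parityClause j true sp} mt'' (x∈parityClause h) (λ e → x≢t jn (≤-trans z<s h) (cong proj₁ e))
      (¬isUniv-x (≤-trans z<s h) jn) ,
    ∈-learnStep-red⁺ {Q} {parityClause j true sp} mt'' (prevVar∈parityClause h) (λ e → prevVar≢t h (cong proj₁ e)) (¬isUniv-prevVar h jn)
    where
    nn : ~ (n + j , not sp) ≡ (n + j , sp)
    nn = cong (n + j ,_) (not-involutive sp)
    mt' : (n + j , sp) ∈ red P Q
    mt' = ∈-red⁺-nonUniv Q mt (¬isUniv-t h jn)
    mt'' : (~ (n + j , not sp)) ∈ red P Q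
    mt'' = subst (_∈ red P Q) (sym nn) mt'
    hQ : ∀ {ℓ} → ℓ ∈ Q → var ℓ ≡ 0 ⊎ ℓ ≡ (n + j , sp)
    hQ m with sub m
    ... | inj₁ v = inj₁ v
    ... | inj₂ (here e) = inj₂ e
    hA : ∀ {ℓ} → ℓ ∈ parityClause j true sp → ℓ ≡ (n + j , not sp) ⊎ ℓ ∈ ((j , true) ∷ (prevVar j , sp) ∷ [])
    hA m with ∈-parityClause⁻ m
    ... | inj₁ e = inj₂ (here e)
    ... | inj₂ (inj₁ e) = inj₂ (there (here e))
    ... | inj₂ (inj₂ e) = inj₁ e

  learnt-TZ : ∀ {j Q L} sp → 2 ≤ j → j ≤ n → TZ j (not sp) Q → XP j sp L →
    let C₁ = learnStep P (n + j , sp) (parityClause j false sp) (red P Q)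
        D = learnStep P (j , true) L C₁ in
    Within D ((prevVar j , sp) ∷ []) × (prevVar j , sp) ∈ D × (3 ≤ j → HasZ D) ×
    (j , false) ∈ C₁ × Within C₁ ((j , false) ∷ (prevVar j , sp) ∷ [])
  learnt-TZ {j} {Q} {L} sp h jn (subQ , mt , (z , mz , vz)) (subL , _ , _) =
    learnStep-Within {C1} {L} {j , true} mx1 sub1 subL ,
    ∈-learnStep⁺ {C1} {L} {j , true} mx1 mp1 (λ e → prevVar≢x h jn (cong proj₁ e)) (¬isUniv-prevVar h jn) ,
    hz ,
    mx1 , sub1
    where
    A = parityClause j false sp
    C1 = learnStep P (n + j , sp) A (red P Q)
    j1 = ≤-trans z<s h
    mt' : (n + j , not sp) ∈ red P Q
    mt' = ∈-red⁺-nonUniv Q mt (¬isUniv-t h jn)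
    hQ : ∀ {ℓ} → ℓ ∈ Q → var ℓ ≡ 0 ⊎ ℓ ≡ (n + j , not sp)
    hQ m with subQ m
    ... | inj₁ v = inj₁ v
    ... | inj₂ (here e) = inj₂ e
    hA : ∀ {ℓ} → ℓ ∈ A → ℓ ≡ (n + j , sp) ⊎ ℓ ∈ ((j , false) ∷ (prevVar j , sp) ∷ [])
    hA m with ∈-parityClause⁻ m
    ... | inj₁ e = inj₂ (here e)
    ... | inj₂ (inj₁ e) = inj₂ (there (here e))
    ... | inj₂ (inj₂ e) = inj₁ e
    sub1 : Within C1 ((j , false) ∷ (prevVar j , sp) ∷ [])
    sub1 = learnStep-red-Within {Q} {A} {n + j , sp} {n + j , not sp} refl mt' hQ hA
    mx1 : (j , false) ∈ C1
    mx1 = ∈-learnStep-red⁺ {Q} {A} mt' (x∈parityClause h) (λ e → x≢t jn j1 (cong proj₁ e)) (¬isUniv-x j1 jn)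
    mp1 : (prevVar j , sp) ∈ C1
    mp1 = ∈-learnStep-red⁺ {Q} {A} mt' (prevVar∈parityClause h) (λ e → prevVar≢t h (cong proj₁ e)) (¬isUniv-prevVar h jn)
    z≢ : ∀ {v b} → v ≢ 0 → z ≢ (v , b)
    z≢ ne e = ne (trans (sym (cong proj₁ e)) vz)
    -- z stays blocked by p_j = t_{j-1}, which is in the last block only when 3 ≤ j.
    hz : 3 ≤ j → HasZ (learnStep P (j , true) L C1)
    hz h3 = z , zR , vz
      where
      lz≤ : lv P (var z) ≤ lv P (prevVar j)
      lz≤ = subst₂ _≤_ (sym (trans (cong (lv P) vz) lv-z)) (sym (lv-prevVar h3 jn)) sz<ss
      lzt : lv P (var z) ≤ lv P (n + j)
      lzt = subst (λ v → lv P v ≤ lv P (n + j)) (sym vz) (lv-z≤lv-t h jn)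
      zQ : z ∈ red P Q
      zQ = ∈-red⁺-blocked Q mz mt (isEx-t {j} h jn) lzt
      zC1 : z ∈ C1
      zC1 rewrite learnStep-resolves P (n + j , sp) A (red P Q) mt' =
        ∈-red⁺-blocked _ (∈-resolve⁺ˡ (n + j , sp) (red P Q) (red P A) zQ (z≢ (λ e → x≢t z≤n (≤-trans z<s h) (sym e))))
                  (∈-resolve⁺ʳ (n + j , sp) (red P Q) (red P A) (∈-red⁺-nonUniv A (prevVar∈parityClause h) (¬isUniv-prevVar h jn))
                    (λ e → prevVar≢t h (cong proj₁ e)))
                  (isEx-prevVar h jn) lz≤
      zR : z ∈ learnStep P (j , true) L C1
      zR rewrite learnStep-resolves P (j , true) L C1 mx1 =
        ∈-red⁺-blocked _ (∈-resolve⁺ˡ (j , true) C1 (red P L) zC1 (z≢ (λ e → <⇒≢ j1 (sym e))))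
                  (∈-resolve⁺ˡ (j , true) C1 (red P L) mp1 (λ e → prevVar≢x h jn (cong proj₁ e)))
                  (isEx-prevVar h jn) lz≤

  learnt-empty : ∀ {C M} → (1 , false) ∈ C → Within C ((1 , false) ∷ []) → Within M ((1 , true) ∷ []) → learnStep P (1 , true) M C ≡ []
  learnt-empty {C} {M} m hC hM rewrite learnStep-resolves P (1 , true) M C m = red-onlyZ _ el
    where
    el : ∀ {ℓ} → ℓ ∈ resolve (1 , true) C (red P M) → var ℓ ≡ 0
    el m' with ∈-resolve⁻ (1 , true) C (red P M) m'
    ... | inj₁ (m1 , ne) with hC m1
    ... | inj₁ v = v
    ... | inj₂ (here e) = ⊥-elim (ne e)
    el m' | inj₂ (m2 , ne) with hM (red-⊆ M m2)
    ... | inj₁ v = v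
    ... | inj₂ (here e) = ⊥-elim (ne e)

  State-≡ : ∀ {f a b pre pre'} → pre ≡ pre' → State f a b (assigned pre) → State f a b (assigned pre')
  State-≡ {f} {a} {b} e c = subst (λ q → State f a b (assigned q)) e c

  trailD-tail : ℕ → Clause → Clause → Trail
  trailD-tail m L Nc = prop (suc m , true) L ∷ prop (n + suc m , true) (parityClause (suc m) false true) ∷ confl Nc ∷ []

  trailD : ℕ → Clause → Clause → Trail
  trailD m L Nc = zeros m ++ trailD-tail m L Nc

  t-true-ok : ∀ {S} → ⊇Matrix S → ∀ m (e : Entry) → 1 ≤ m → suc m ≤ n → assigned (e ∷ []) ≡ (suc m , true) ∷ [] →
    EntryOKBefore P S (zeros m ++ e ∷ []) (prop (n + suc m , true) (parityClause (suc m) false true))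
  t-true-ok {S} mi m e h le ae =
    propagation-ok (zeros m ++ e ∷ []) _ _ (mi (∈-Matrix⁺ false true (s≤s h) le)) (t-unassigned c le ≤-refl)
      (parityClause-unit c le (s≤s h) le ≤-refl (contains c {suc m , true} (inj₁ (suc m , z<s , ≤-refl , cong (suc m ,_) (sym (oneAt-self m)))))
        (subst (λ b → (prevVar (suc m) , b) ∈ assigned (zeros m ++ e ∷ [])) (prevParity-oneAt m) (prevVar-value c z<s (suc m) (s≤s h) ≤-refl)))
    where
    c : State (oneAt m) (suc m) m (assigned (zeros m ++ e ∷ []))
    c = subst (State (oneAt m) (suc m) m) (sym (trans (assigned-++ (zeros m) (e ∷ [])) (cong (assignedZeros m ++_) ae))) (State-zeros-x1 m)

  trailD-ok : ∀ {S m L Nc} → ⊇Matrix S → L ∈ S → Nc ∈ S → XP (suc m) true L → TZ (suc m) false Nc → 1 ≤ m → suc m ≤ n →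
         ConflictTrail P S (trailD m L Nc)
  trailD-ok {S} {m} {L} {Nc} mi mL mN (subL , mxL , _) (subN , _ , _) h le =
    conflictTrail-++ P S (zeros m) _ Nc (AllAfter-++ (EntryOKBefore P S) [] (zeros m) _ (zeros-ok mi m (<⇒≤ le)) (e1 , e2 , tt)) mN
      (conflict-on-z c3 le cond)
    where
    c0 = State-zeros m
    e1 : EntryOKBefore P S (zeros m) (prop (suc m , true) L)
    e1 = propagation-ok (zeros m) _ _ mL (x-unassigned c0 (<⇒≤ le) ≤-refl le) (x-unit c0 (<⇒≤ le) z<s le ≤-refl mxL hC)
      where
      hC : ∀ {ℓ} → ℓ ∈ L → var ℓ ≡ 0 ⊎ ℓ ≡ (suc m , true) ⊎ (~ ℓ) ∈ assignedZeros m
      hC m' with subL m'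
      ... | inj₁ v = inj₁ v
      ... | inj₂ (here e) = inj₂ (inj₁ e)
      ... | inj₂ (there (here refl)) = inj₂
        (inj₂ (subst (λ b → (prevVar (suc m) , b) ∈ assignedZeros m) (prevParity-allFalse (suc m)) (prevVar-value c0 h (suc m) (s≤s h) ≤-refl)))
    e2 = t-true-ok mi m (prop (suc m , true) L) h le refl
    c3 : State (oneAt m) (suc m) (suc m)
      (assigned (zeros m ++ prop (suc m , true) L ∷ prop (n + suc m , true) (parityClause (suc m) false true) ∷ []))
    c3 = subst (State (oneAt m) (suc m) (suc m)) (trans (++-assoc (assignedZeros m) _ _) (sym (assigned-++ (zeros m) _))) (State-zeros-x1t m h)
    σ3 = assigned (zeros m ++ prop (suc m , true) L ∷ prop (n + suc m , true) (parityClause (suc m) false true) ∷ [])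
    cond : ∀ {ℓ} → ℓ ∈ Nc → var ℓ ≡ 0 ⊎ (~ ℓ) ∈ σ3
    cond m' with subN m'
    ... | inj₁ v = inj₁ v
    ... | inj₂ (here refl) = inj₂ (subst (λ b → (n + suc m , b) ∈ σ3) (parity-oneAt m) (t-value c3 (s≤s h) ≤-refl))

  trailD-learns : ∀ m L Nc → learnStep P (suc m , true) L
    (learnStep P (n + suc m , true) (parityClause (suc m) false true) (red P Nc)) ∈ Learnable P (trailD m L Nc)
  trailD-learns m L Nc = subst (C ∈_) (sym (Learnable-++ P (zeros m) (trailD-tail m L Nc))) (there (there (learnSeq-head P (reverse (zeros m)) C)))
    where C = learnStep P (suc m , true) L (learnStep P (n + suc m , true) (parityClause (suc m) false true) (red P Nc))

  trailD-restart : ∀ {S L Pc Nc m} → Invariant (suc m) S → XP (suc m) true L → 1 ≤ m → suc m ≤ n →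
          Restart P (S ++ L ∷ []) (trailC m Pc) (trailD m L Nc)
  trailD-restart {S} {L} {Pc} {Nc} {m} inv kl h le =
    restart P (S ++ L ∷ []) (zeros m) (trailD-tail m L Nc) (trailC m Pc) _ refl
      (natural-propagation (zeros m) (suc m , true) L
        (∈-∷ʳ-elim {S = S} (Invariant-¬conflict (s≤s h) inv c0 (<⇒≤ le) le ≤-refl ≤-refl (n≤1+n m)) (XP-¬conflict c0 (<⇒≤ le) le ≤-refl kl)) ,
       natural-propagation (zeros m ++ prop (suc m , true) L ∷ []) (n + suc m , true) (parityClause (suc m) false true)
         (∈-∷ʳ-elim {S = S} (Invariant-¬conflict (s≤s h) inv c1 le le (n≤1+n m) ≤-refl ≤-refl)
           (XP-satisfied-x (contains c1 {suc m , true} (inj₁ (suc m , z<s , ≤-refl , cong (suc m ,_) (sym (oneAt-self m))))) kl nothing)) ,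
       natural-conflict {S ++ L ∷ []} {(zeros m ++ prop (suc m , true) L ∷ []) ++ prop (n + suc m , true)
         (parityClause (suc m) false true) ∷ []} {Nc} , tt)
    where
    c0 = State-zeros m
    c1 : State (oneAt m) (suc m) m (assigned (zeros m ++ prop (suc m , true) L ∷ []))
    c1 = State-∷ʳ (zeros m) (prop (suc m , true) L) (State-zeros-x1 m)

  trailC-learns : ∀ m Pc → learnStep P (n + suc m , false) (parityClause (suc m) true true) (red P Pc) ∈ Learnable P (trailC m Pc)
  trailC-learns m Pc = subst (C ∈_) (sym (Learnable-++ P (zeros m) _)) (there (learnSeq-head P (dec (suc m , false) ∷ reverse (zeros m)) C))
    where C = learnStep P (n + suc m , false) (parityClause (suc m) true true) (red P Pc)

  module TrailsAB (k : ℕ) where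
    m : ℕ
    m = suc k
    decPrev : Entry
    decPrev = dec (suc m , true)
    propTPrev : Entry
    propTPrev = prop (n + suc m , true) (parityClause (suc m) false true)

    state₁ : State (oneAt m) (suc m) m (assigned (zeros m ++ decPrev ∷ []))
    state₁ = State-∷ʳ (zeros m) decPrev (State-zeros-x1 m)
    state₂ : State (oneAt m) (suc m) (suc m) (assigned ((zeros m ++ decPrev ∷ []) ++ propTPrev ∷ []))
    state₂ = State-∷ʳ (zeros m ++ decPrev ∷ []) propTPrev (State-assign-t state₁ z<s (parity-oneAt m))
    oneAt-next : oneAt m (suc (suc m)) ≡ false
    oneAt-next = >⇒≡ᵇ-false {suc (suc m)} {suc m} ≤-refl
    tPrev∈state₂ : (n + suc m , true) ∈ assigned ((zeros m ++ decPrev ∷ []) ++ propTPrev ∷ [])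
    tPrev∈state₂ = subst (λ b → (n + suc m , b) ∈ assigned ((zeros m ++ decPrev ∷ []) ++ propTPrev ∷ [])) (parity-oneAt m)
      (t-value state₂ (s≤s z<s) ≤-refl)
    shared : Trail
    shared = zeros m ++ decPrev ∷ propTPrev ∷ []
    state₂′ : State (oneAt m) (suc m) (suc m) (assigned shared)
    state₂′ = State-≡ (∷ʳ-assoc₂ (zeros m) decPrev propTPrev) state₂
    tPrev∈state₂′ : (n + suc m , true) ∈ assigned shared
    tPrev∈state₂′ = subst (λ b → (n + suc m , b) ∈ assigned shared) (parity-oneAt m) (t-value state₂′ (s≤s z<s) ≤-refl)
    parity-oneAt-next : parity (oneAt m) (suc (suc m)) ≡ true
    parity-oneAt-next rewrite oneAt-next | parity-oneAt m = refl
    onesAt-next : onesAt m (suc (suc m)) ≡ true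
    onesAt-next = trans (cong (_∨ (suc (suc m) ≡ᵇ suc (suc m))) oneAt-next) (≡ᵇ-refl (suc (suc m)))
    parity-onesAt : parity (onesAt m) (suc m) ≡ true
    parity-onesAt = trans (sym (parity-cong (oneAt≗onesAt m) (suc m) z<s ≤-refl)) (parity-oneAt m)
    parity-onesAt-next : parity (onesAt m) (suc (suc m)) ≡ false
    parity-onesAt-next rewrite onesAt-next | parity-onesAt = refl

    decCur : Entry
    decCur = dec (suc (suc m) , false)
    propTCur : Entry
    propTCur = prop (n + suc (suc m) , true) (parityClause (suc (suc m)) true false)
    trailA-tail : Clause → Trail
    trailA-tail Nc = decPrev ∷ propTPrev ∷ decCur ∷ propTCur ∷ confl Nc ∷ []
    trailA : Clause → Trail
    trailA Nc = zeros m ++ trailA-tail Nc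

    state₃ : State (oneAt m) (suc (suc m)) (suc m) (assigned (((zeros m ++ decPrev ∷ []) ++ propTPrev ∷ []) ++ decCur ∷ []))
    state₃ = State-∷ʳ ((zeros m ++ decPrev ∷ []) ++ propTPrev ∷ []) decCur (State-assign-x state₂ oneAt-next)
    state₄ : State (oneAt m) (suc (suc m)) (suc (suc m)) (assigned (zeros m ++ decPrev ∷ propTPrev ∷ decCur ∷ propTCur ∷ []))
    state₄ = State-≡ (∷ʳ-assoc₄ (zeros m) decPrev propTPrev decCur propTCur)
      (State-∷ʳ (((zeros m ++ decPrev ∷ []) ++ propTPrev ∷ []) ++ decCur ∷ []) propTCur (State-assign-t state₃ z<s parity-oneAt-next))

    trailA-ok : ∀ {S Nc} → ⊇Matrix S → Nc ∈ S → TZ (suc (suc m)) false Nc → suc (suc m) ≤ n → ConflictTrail P S (trailA Nc)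
    trailA-ok {S} {Nc} mi mN (subN , _ , _) le =
      conflictTrail-++ P S (zeros m) (decPrev ∷ propTPrev ∷ decCur ∷ propTCur ∷ []) Nc
        (AllAfter-++ (EntryOKBefore P S) [] (zeros m) _ (zeros-ok mi m (<⇒≤ (<⇒≤ le))) (e1 , e2 , e3 , e4 , tt)) mN
        (conflict-on-z state₄ le cond)
      where
      le1 = <⇒≤ le
      e1 : EntryOKBefore P S (zeros m) decPrev
      e1 = decision-ok {S} (zeros m) (suc m) true (State-zeros m) (<⇒≤ le1) ≤-refl le1
      e2 = t-true-ok mi m decPrev z<s le1 refl
      e3 : EntryOKBefore P S ((zeros m ++ decPrev ∷ []) ++ propTPrev ∷ []) decCur
      e3 = decision-ok {S} ((zeros m ++ decPrev ∷ []) ++ propTPrev ∷ []) (suc (suc m)) false state₂ le1 ≤-refl le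
      σ3 = assigned (((zeros m ++ decPrev ∷ []) ++ propTPrev ∷ []) ++ decCur ∷ [])
      e4 : EntryOKBefore P S (((zeros m ++ decPrev ∷ []) ++ propTPrev ∷ []) ++ decCur ∷ []) propTCur
      e4 = propagation-ok (((zeros m ++ decPrev ∷ []) ++ propTPrev ∷ []) ++ decCur ∷ []) (n + suc (suc m) , true)
        (parityClause (suc (suc m)) true false) (mi (∈-Matrix⁺ true false sz<ss le)) (t-unassigned state₃ le ≤-refl)
             (parityClause-unit state₃ le sz<ss le ≤-refl
               (contains state₃ {suc (suc m) , false} (inj₁ (suc (suc m) , z<s , ≤-refl , cong (suc (suc m) ,_) (sym oneAt-next))))
               (subst (λ b → (n + suc m , b) ∈ σ3) (parity-oneAt m) (t-value state₃ (s≤s z<s) ≤-refl)))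
      σ4 = assigned (zeros m ++ decPrev ∷ propTPrev ∷ decCur ∷ propTCur ∷ [])
      cond : ∀ {ℓ} → ℓ ∈ Nc → var ℓ ≡ 0 ⊎ (~ ℓ) ∈ σ4
      cond m' with subN m'
      ... | inj₁ v = inj₁ v
      ... | inj₂ (here refl) = inj₂ (subst (λ b → (n + suc (suc m) , b) ∈ σ4) parity-oneAt-next (t-value state₄ sz<ss ≤-refl))

    trailA-learns : ∀ Nc → learnStep P (n + suc (suc m) , true) (parityClause (suc (suc m)) true false) (red P Nc) ∈ Learnable P (trailA Nc)
    trailA-learns Nc = subst (C ∈_) (sym (Learnable-++ P (zeros m) (trailA-tail Nc)))
      (there (learnSeq-head P (decCur ∷ propTPrev ∷ decPrev ∷ reverse (zeros m)) C))
      where C = learnStep P (n + suc (suc m) , true) (parityClause (suc (suc m)) true false) (red P Nc)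

    trailA-restart : ∀ {S L2 P' Nc} → Invariant (suc (suc m)) S → XP (suc (suc m)) true L2 → TZ (suc m) true P' → suc (suc m) ≤ n →
            Restart P ((S ++ L2 ∷ []) ++ P' ∷ []) (trailD (suc m) L2 Nc) (trailA Nc)
    trailA-restart {S} {L2} {P'} {Nc} inv kl kt le =
      restart P ((S ++ L2 ∷ []) ++ P' ∷ []) (zeros m) (trailA-tail Nc) (trailD (suc m) L2 Nc) _
        (++-assoc (zeros m) (zeroStep m) (trailD-tail (suc m) L2 Nc))
        (n1 , n2 , n3 , n4 , natural-conflict {(S ++ L2 ∷ []) ++ P' ∷ []} {(((zeros m ++ decPrev ∷ []) ++ propTPrev ∷ []) ++ decCur ∷ []) ++ propTCur ∷ []} {Nc} , tt)
      where
      le1 = <⇒≤ le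
      le0 = <⇒≤ le1
      n1 = natural-decision (zeros m) (suc m , true)
        (∈-∷ʳ-elim {S = S ++ L2 ∷ []} (∈-∷ʳ-elim {S = S} (Invariant-NotUnit sz<ss inv (State-zeros m) le1 (n≤1+n _))
          (XP-NotUnit (State-zeros m) le0 le (n≤1+n _) ≤-refl kl)) (TZ-NotUnit (State-zeros m) le0 (s≤s z<s) le1 ≤-refl kt))
      n2 = natural-propagation (zeros m ++ decPrev ∷ []) (n + suc m , true) (parityClause (suc m) false true)
        (∈-∷ʳ-elim {S = S ++ L2 ∷ []} (∈-∷ʳ-elim {S = S} (Invariant-¬conflict sz<ss inv state₁ le1 le1 (n≤1+n _) (n≤1+n _) (n≤1+n _))
          (XP-NotUnit state₁ le1 le ≤-refl ≤-refl kl nothing)) (TZ-NotUnit state₁ le1 (s≤s z<s) le1 ≤-refl kt nothing))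
      n3 = natural-decision ((zeros m ++ decPrev ∷ []) ++ propTPrev ∷ []) (suc (suc m) , false)
        (∈-∷ʳ-elim {S = S ++ L2 ∷ []} (∈-∷ʳ-elim {S = S} (Invariant-NotUnit sz<ss inv state₂ le ≤-refl) (XP-satisfied-p tPrev∈state₂ kl))
          (TZ-satisfied tPrev∈state₂ kt))
      tPrev∈state₃ : (n + suc m , true) ∈ assigned (((zeros m ++ decPrev ∷ []) ++ propTPrev ∷ []) ++ decCur ∷ [])
      tPrev∈state₃ = subst (λ b → (n + suc m , b) ∈ assigned (((zeros m ++ decPrev ∷ []) ++ propTPrev ∷ []) ++ decCur ∷ []))
        (parity-oneAt m) (t-value {j = suc m} state₃ (s≤s z<s) ≤-refl)
      n4 = natural-propagation (((zeros m ++ decPrev ∷ []) ++ propTPrev ∷ []) ++ decCur ∷ []) (n + suc (suc m) , true)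
        (parityClause (suc (suc m)) true false)
        (∈-∷ʳ-elim {S = S ++ L2 ∷ []}
          (∈-∷ʳ-elim {S = S} (Invariant-¬conflict sz<ss inv state₃ le le (n≤1+n _) ≤-refl ≤-refl) (XP-satisfied-p tPrev∈state₃ kl nothing))
          (TZ-satisfied tPrev∈state₃ kt nothing))

    propXCur : Clause → Entry
    propXCur L1 = prop (suc (suc m) , true) L1
    propTCur′ : Entry
    propTCur′ = prop (n + suc (suc m) , false) (parityClause (suc (suc m)) false false)
    trailB-rest : Clause → Clause → Trail
    trailB-rest L1 Pc = propXCur L1 ∷ propTCur′ ∷ confl Pc ∷ []
    trailB-tail : Clause → Clause → Trail
    trailB-tail L1 Pc = decPrev ∷ propTPrev ∷ trailB-rest L1 Pc
    trailB : Clause → Clause → Trail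
    trailB L1 Pc = zeros m ++ trailB-tail L1 Pc

    state₃ᴮ : ∀ L1 → State (onesAt m) (suc (suc m)) (suc m) (assigned (((zeros m ++ decPrev ∷ []) ++ propTPrev ∷ []) ++ propXCur L1 ∷ []))
    state₃ᴮ L1 = State-∷ʳ ((zeros m ++ decPrev ∷ []) ++ propTPrev ∷ []) (propXCur L1)
      (State-assign-x (State-cong state₂ ≤-refl (oneAt≗onesAt m)) onesAt-next)
    state₄ᴮ : ∀ L1 → State (onesAt m) (suc (suc m)) (suc (suc m)) (assigned (zeros m ++ decPrev ∷ propTPrev ∷ propXCur L1 ∷ propTCur′ ∷ []))
    state₄ᴮ L1 = State-≡ (∷ʳ-assoc₄ (zeros m) decPrev propTPrev (propXCur L1) propTCur′)
      (State-∷ʳ (((zeros m ++ decPrev ∷ []) ++ propTPrev ∷ []) ++ propXCur L1 ∷ []) propTCur′ (State-assign-t (state₃ᴮ L1) z<s parity-onesAt-next))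

    trailB-ok : ∀ {S L1 Pc} → ⊇Matrix S → L1 ∈ S → Pc ∈ S → XP (suc (suc m)) false L1 → TZ (suc (suc m)) true Pc → suc (suc m) ≤ n →
           ConflictTrail P S (trailB L1 Pc)
    trailB-ok {S} {L1} {Pc} mi mL mP (subL , mxL , _) (subP , _ , _) le =
      conflictTrail-++ P S (zeros m) (decPrev ∷ propTPrev ∷ propXCur L1 ∷ propTCur′ ∷ []) Pc
        (AllAfter-++ (EntryOKBefore P S) [] (zeros m) _ (zeros-ok mi m (<⇒≤ (<⇒≤ le))) (e1 , e2 , e3 , e4 , tt)) mP
        (conflict-on-z (state₄ᴮ L1) le cond)
      where
      le1 = <⇒≤ le
      e1 : EntryOKBefore P S (zeros m) decPrev
      e1 = decision-ok {S} (zeros m) (suc m) true (State-zeros m) (<⇒≤ le1) ≤-refl le1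
      e2 = t-true-ok mi m decPrev z<s le1 refl
      σ2 = assigned ((zeros m ++ decPrev ∷ []) ++ propTPrev ∷ [])
      e3 : EntryOKBefore P S ((zeros m ++ decPrev ∷ []) ++ propTPrev ∷ []) (propXCur L1)
      e3 = propagation-ok ((zeros m ++ decPrev ∷ []) ++ propTPrev ∷ []) (suc (suc m) , true) L1 mL (x-unassigned state₂ le1 ≤-refl le)
        (x-unit state₂ le1 z<s le ≤-refl mxL hC)
        where
        hC : ∀ {ℓ} → ℓ ∈ L1 → var ℓ ≡ 0 ⊎ ℓ ≡ (suc (suc m) , true) ⊎ (~ ℓ) ∈ σ2
        hC m' with subL m'
        ... | inj₁ v = inj₁ v
        ... | inj₂ (here e) = inj₂ (inj₁ e)
        ... | inj₂ (there (here refl)) = inj₂ (inj₂ tPrev∈state₂)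
      σ3 = assigned (((zeros m ++ decPrev ∷ []) ++ propTPrev ∷ []) ++ propXCur L1 ∷ [])
      e4 : EntryOKBefore P S (((zeros m ++ decPrev ∷ []) ++ propTPrev ∷ []) ++ propXCur L1 ∷ []) propTCur′
      e4 = propagation-ok (((zeros m ++ decPrev ∷ []) ++ propTPrev ∷ []) ++ propXCur L1 ∷ []) (n + suc (suc m) , false)
        (parityClause (suc (suc m)) false false)
             (mi (∈-Matrix⁺ false false sz<ss le)) (t-unassigned (state₃ᴮ L1) le ≤-refl)
             (parityClause-unit (state₃ᴮ L1) le sz<ss le ≤-refl
               (contains (state₃ᴮ L1) {suc (suc m) , true} (inj₁ (suc (suc m) , z<s , ≤-refl , cong (suc (suc m) ,_) (sym onesAt-next))))
               (subst (λ b → (n + suc m , b) ∈ σ3) parity-onesAt (t-value {j = suc m} (state₃ᴮ L1) (s≤s z<s) ≤-refl)))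
      σ4 = assigned (zeros m ++ decPrev ∷ propTPrev ∷ propXCur L1 ∷ propTCur′ ∷ [])
      cond : ∀ {ℓ} → ℓ ∈ Pc → var ℓ ≡ 0 ⊎ (~ ℓ) ∈ σ4
      cond m' with subP m'
      ... | inj₁ v = inj₁ v
      ... | inj₂ (here refl) = inj₂ (subst (λ b → (n + suc (suc m) , b) ∈ σ4) parity-onesAt-next (t-value (state₄ᴮ L1) sz<ss ≤-refl))

    trailB-learns : ∀ L1 Pc → learnStep P (suc (suc m) , true) L1
      (learnStep P (n + suc (suc m) , false) (parityClause (suc (suc m)) false false) (red P Pc)) ∈ Learnable P (trailB L1 Pc)
    trailB-learns L1 Pc = subst (C ∈_) (sym (Learnable-++ P (zeros m) (trailB-tail L1 Pc)))
      (there (there (learnSeq-head P (propTPrev ∷ decPrev ∷ reverse (zeros m)) C)))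
      where C = learnStep P (suc (suc m) , true) L1 (learnStep P (n + suc (suc m) , false) (parityClause (suc (suc m)) false false) (red P Pc))

    trailB-restart : ∀ {S L2 P' L1 Pc Nc} → Invariant (suc (suc m)) S → XP (suc (suc m)) true L2 → TZ (suc m) true P' → XP
      (suc (suc m)) false L1 → suc (suc m) ≤ n →
            Restart P (((S ++ L2 ∷ []) ++ P' ∷ []) ++ L1 ∷ []) (trailA Nc) (trailB L1 Pc)
    trailB-restart {S} {L2} {P'} {L1} {Pc} {Nc} inv kl kt kl1 le =
      restart′ P S3 shared (trailB-rest L1 Pc) (trailB L1 Pc) (trailA Nc) (decCur ∷ propTCur ∷ confl Nc ∷ [])
        (sym (++-assoc (zeros m) (decPrev ∷ propTPrev ∷ []) (trailB-rest L1 Pc)))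
          (sym (++-assoc (zeros m) (decPrev ∷ propTPrev ∷ []) (decCur ∷ propTCur ∷ confl Nc ∷ [])))
        (n1 , n2 , natural-conflict {S3} {(shared ++ propXCur L1 ∷ []) ++ propTCur′ ∷ []} {Pc} , tt)
      where
      S3 = ((S ++ L2 ∷ []) ++ P' ∷ []) ++ L1 ∷ []
      le1 = <⇒≤ le
      n1 = natural-propagation shared (suc (suc m) , true) L1
        (∈-∷ʳ-elim {S = (S ++ L2 ∷ []) ++ P' ∷ []}
          (∈-∷ʳ-elim {S = S ++ L2 ∷ []} (∈-∷ʳ-elim {S = S} (Invariant-¬conflict sz<ss inv state₂′ le1 le ≤-refl ≤-refl (n≤1+n _))
          (XP-satisfied-p tPrev∈state₂′ kl nothing)) (TZ-satisfied tPrev∈state₂′ kt nothing)) (XP-¬conflict state₂′ le1 le ≤-refl kl1))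
      state₃′ : State (onesAt m) (suc (suc m)) (suc m) (assigned (shared ++ propXCur L1 ∷ []))
      state₃′ = State-∷ʳ shared (propXCur L1) (State-assign-x (State-cong state₂′ ≤-refl (oneAt≗onesAt m)) onesAt-next)
      tPrev∈state₃′ : (n + suc m , true) ∈ assigned (shared ++ propXCur L1 ∷ [])
      tPrev∈state₃′ = subst (λ b → (n + suc m , b) ∈ assigned (shared ++ propXCur L1 ∷ [])) parity-onesAt
        (t-value {j = suc m} state₃′ (s≤s z<s) ≤-refl)
      xCur∈state₃′ : (suc (suc m) , true) ∈ assigned (shared ++ propXCur L1 ∷ [])
      xCur∈state₃′ = contains state₃′ {suc (suc m) , true} (inj₁ (suc (suc m) , z<s , ≤-refl , cong (suc (suc m) ,_) (sym onesAt-next)))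
      n2 = natural-propagation (shared ++ propXCur L1 ∷ []) (n + suc (suc m) , false) (parityClause (suc (suc m)) false false)
        (∈-∷ʳ-elim {S = (S ++ L2 ∷ []) ++ P' ∷ []}
          (∈-∷ʳ-elim {S = S ++ L2 ∷ []} (∈-∷ʳ-elim {S = S} (Invariant-¬conflict sz<ss inv state₃′ le le (n≤1+n _) ≤-refl ≤-refl)
          (XP-satisfied-p tPrev∈state₃′ kl nothing)) (TZ-satisfied tPrev∈state₃′ kt nothing)) (XP-satisfied-x xCur∈state₃′ kl1 nothing))

  1≤n : 1 ≤ n
  1≤n = ≤-trans z<s 2≤n

  module TrailsEF (M M' N₂ P₂ : Clause) where
    x1 : Entry
    x1 = prop (1 , true) M
    trailE : Trail
    trailE = x1 ∷ dec (2 , false) ∷ prop (n + 2 , true) (parityClause 2 true false) ∷ confl N₂ ∷ []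
    trailF : Trail
    trailF = x1 ∷ prop (2 , true) M' ∷ prop (n + 2 , false) (parityClause 2 false false) ∷ confl P₂ ∷ []

    cE1 : State (oneAt 0) 1 1 ((1 , true) ∷ [])
    cE1 = State-b0⇒b1 (State-zeros-x1 0)
    cE2 : State (oneAt 0) 2 1 ((1 , true) ∷ (2 , false) ∷ [])
    cE2 = State-assign-x cE1 refl
    cE3 : State (oneAt 0) 2 2 ((1 , true) ∷ (2 , false) ∷ (n + 2 , true) ∷ [])
    cE3 = State-assign-t cE2 ≤-refl refl
    cF1 : State (onesAt 0) 1 1 ((1 , true) ∷ [])
    cF1 = State-b0⇒b1 (State-assign-x State-empty refl)
    cF2 : State (onesAt 0) 2 1 ((1 , true) ∷ (2 , true) ∷ [])
    cF2 = State-assign-x cF1 refl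
    cF3 : State (onesAt 0) 2 2 ((1 , true) ∷ (2 , true) ∷ (n + 2 , false) ∷ [])
    cF3 = State-assign-t cF2 ≤-refl refl

    e1 : ∀ {S} → M ∈ S → Within M ((1 , true) ∷ []) → (1 , true) ∈ M → EntryOKBefore P S [] x1
    e1 mM sub mx = propagation-ok [] (1 , true) M mM (x-unassigned (State-empty {allFalse}) z≤n z<s 1≤n)
      (x-unit (State-empty {allFalse}) z≤n ≤-refl 1≤n z<s mx hC)
      where
      hC : ∀ {ℓ} → ℓ ∈ M → var ℓ ≡ 0 ⊎ ℓ ≡ (1 , true) ⊎ (~ ℓ) ∈ []
      hC m with sub m
      ... | inj₁ v = inj₁ v
      ... | inj₂ (here e) = inj₂ (inj₁ e)

    trailE-ok : ∀ {S} → ⊇Matrix S → M ∈ S → N₂ ∈ S → Within M ((1 , true) ∷ []) → (1 , true) ∈ M → TZ 2 false N₂ → ConflictTrail P S trailE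
    trailE-ok {S} mi mM mN sub mx (subN , _ , _) =
      conflictTrail-++ P S [] (x1 ∷ dec (2 , false) ∷ prop (n + 2 , true) (parityClause 2 true false) ∷ []) N₂
        (e1 mM sub mx , e2 , e3 , tt) mN (conflict-on-z cE3 2≤n cond)
      where
      e2 : EntryOKBefore P S (x1 ∷ []) (dec (2 , false))
      e2 = decision-ok {S} (x1 ∷ []) 2 false cE1 1≤n ≤-refl 2≤n
      e3 : EntryOKBefore P S (x1 ∷ dec (2 , false) ∷ []) (prop (n + 2 , true) (parityClause 2 true false))
      e3 = propagation-ok (x1 ∷ dec (2 , false) ∷ []) (n + 2 , true) (parityClause 2 true false) (mi (∈-Matrix⁺ true false ≤-refl 2≤n))
        (t-unassigned cE2 2≤n ≤-refl)
             (parityClause-unit cE2 2≤n ≤-refl 2≤n ≤-refl (there (here refl)) (here refl))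
      cond : ∀ {ℓ} → ℓ ∈ N₂ → var ℓ ≡ 0 ⊎ (~ ℓ) ∈ ((1 , true) ∷ (2 , false) ∷ (n + 2 , true) ∷ [])
      cond m with subN m
      ... | inj₁ v = inj₁ v
      ... | inj₂ (here refl) = inj₂ (there (there (here refl)))

    trailE-learns : learnStep P (n + 2 , true) (parityClause 2 true false) (red P N₂) ∈ Learnable P trailE
    trailE-learns = there (learnSeq-head P (dec (2 , false) ∷ x1 ∷ []) _)

    trailE-restart : ∀ {S L2} → Invariant 2 S → XP 2 true L2 → (1 , true) ∈ M → Restart P ((S ++ L2 ∷ []) ++ M ∷ []) (trailD 1 L2 N₂) trailE
    trailE-restart {S} {L2} inv kl mx =
      restart P ((S ++ L2 ∷ []) ++ M ∷ []) [] trailE (trailD 1 L2 N₂) (trailD 1 L2 N₂) refl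
        (n1 , n2 , n3 , natural-conflict {(S ++ L2 ∷ []) ++ M ∷ []} {x1 ∷ dec (2 , false) ∷ prop (n + 2 , true)
          (parityClause 2 true false) ∷ []} {N₂} , tt)
      where
      n1 = natural-propagation [] (1 , true) M
        (∈-∷ʳ-elim {S = S ++ L2 ∷ []}
          (∈-∷ʳ-elim {S = S} (Invariant-¬conflict ≤-refl inv (State-empty {allFalse}) z≤n 1≤n z≤n z<s z≤n) (XP-¬conflict (State-empty {allFalse}) z≤n 2≤n z<s kl))
          (survivor⇒¬conflict [] M mx (x-unassigned (State-empty {allFalse}) z≤n z<s 1≤n) (inj₁ (¬isUniv-x {1} ≤-refl 1≤n))))
      n2 = natural-decision (x1 ∷ []) (2 , false)
        (∈-∷ʳ-elim {S = S ++ L2 ∷ []}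
          (∈-∷ʳ-elim {S = S} (Invariant-NotUnit ≤-refl inv cE1 2≤n ≤-refl) (XP-satisfied-p {(1 , true) ∷ []} (here refl) kl))
          (satisfied⇒NotUnit ((1 , true) ∷ []) M mx (here refl)))
      n3 = natural-propagation (x1 ∷ dec (2 , false) ∷ []) (n + 2 , true) (parityClause 2 true false)
        (∈-∷ʳ-elim {S = S ++ L2 ∷ []}
          (∈-∷ʳ-elim {S = S} (Invariant-¬conflict ≤-refl inv cE2 2≤n 2≤n (n≤1+n 1) ≤-refl ≤-refl) (XP-satisfied-p {(1 , true) ∷ (2 , false) ∷ []} (here refl) kl nothing))
          (satisfied⇒NotUnit ((1 , true) ∷ (2 , false) ∷ []) M mx (here refl) nothing))

    trailF-ok : ∀ {S} → ⊇Matrix S → M ∈ S → M' ∈ S → P₂ ∈ S → Within M ((1 , true) ∷ []) → (1 , true) ∈ M → XP 2 false M' → TZ 2 true P₂ →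
           ConflictTrail P S trailF
    trailF-ok {S} mi mM mM' mP sub mx (subM' , mx' , _) (subP , _ , _) =
      conflictTrail-++ P S [] (x1 ∷ prop (2 , true) M' ∷ prop (n + 2 , false) (parityClause 2 false false) ∷ []) P₂
        (e1 mM sub mx , e2 , e3 , tt) mP (conflict-on-z cF3 2≤n cond)
      where
      e2 : EntryOKBefore P S (x1 ∷ []) (prop (2 , true) M')
      e2 = propagation-ok (x1 ∷ []) (2 , true) M' mM' (x-unassigned cE1 1≤n ≤-refl 2≤n) (x-unit cE1 1≤n z<s 2≤n ≤-refl mx' hC)
        where
        hC : ∀ {ℓ} → ℓ ∈ M' → var ℓ ≡ 0 ⊎ ℓ ≡ (2 , true) ⊎ (~ ℓ) ∈ ((1 , true) ∷ [])
        hC m with subM' m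
        ... | inj₁ v = inj₁ v
        ... | inj₂ (here e) = inj₂ (inj₁ e)
        ... | inj₂ (there (here refl)) = inj₂ (inj₂ (here refl))
      e3 : EntryOKBefore P S (x1 ∷ prop (2 , true) M' ∷ []) (prop (n + 2 , false) (parityClause 2 false false))
      e3 = propagation-ok (x1 ∷ prop (2 , true) M' ∷ []) (n + 2 , false) (parityClause 2 false false)
        (mi (∈-Matrix⁺ false false ≤-refl 2≤n)) (t-unassigned cF2 2≤n ≤-refl)
             (parityClause-unit cF2 2≤n ≤-refl 2≤n ≤-refl (there (here refl)) (here refl))
      cond : ∀ {ℓ} → ℓ ∈ P₂ → var ℓ ≡ 0 ⊎ (~ ℓ) ∈ ((1 , true) ∷ (2 , true) ∷ (n + 2 , false) ∷ [])
      cond m with subP m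
      ... | inj₁ v = inj₁ v
      ... | inj₂ (here refl) = inj₂ (there (there (here refl)))

    C3 : Clause
    C3 = learnStep P (1 , true) M (learnStep P (2 , true) M' (learnStep P (n + 2 , false) (parityClause 2 false false) (red P P₂)))

    trailF-learns : C3 ∈ Learnable P trailF
    trailF-learns = there (there (there (here refl)))

    trailF-restart : ∀ {S L2} → Invariant 2 S → XP 2 true L2 → (1 , true) ∈ M → XP 2 false M' →
            Restart P (((S ++ L2 ∷ []) ++ M ∷ []) ++ M' ∷ []) trailE trailF
    trailF-restart {S} {L2} inv kl mx kl' =
      restart P S3 (x1 ∷ []) (prop (2 , true) M' ∷ prop (n + 2 , false) (parityClause 2 false false) ∷ confl P₂ ∷ []) trailE _ refl
        (n1 , n2 , natural-conflict {S3} {x1 ∷ prop (2 , true) M' ∷ prop (n + 2 , false) (parityClause 2 false false) ∷ []} {P₂} , tt)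
      where
      S3 = ((S ++ L2 ∷ []) ++ M ∷ []) ++ M' ∷ []
      n1 = natural-propagation (x1 ∷ []) (2 , true) M'
        (∈-∷ʳ-elim {S = (S ++ L2 ∷ []) ++ M ∷ []}
          (∈-∷ʳ-elim {S = S ++ L2 ∷ []} (∈-∷ʳ-elim {S = S} (Invariant-¬conflict ≤-refl inv cE1 1≤n 2≤n ≤-refl ≤-refl (n≤1+n 1))
           (XP-satisfied-p {(1 , true) ∷ []} (here refl) kl nothing)) (satisfied⇒NotUnit ((1 , true) ∷ []) M mx (here refl) nothing))
             (XP-¬conflict cE1 1≤n 2≤n ≤-refl kl'))
      n2 = natural-propagation (x1 ∷ prop (2 , true) M' ∷ []) (n + 2 , false) (parityClause 2 false false)
        (∈-∷ʳ-elim {S = (S ++ L2 ∷ []) ++ M ∷ []}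
          (∈-∷ʳ-elim {S = S ++ L2 ∷ []} (∈-∷ʳ-elim {S = S} (Invariant-¬conflict ≤-refl inv cF2 2≤n 2≤n (n≤1+n 1) ≤-refl ≤-refl)
           (XP-satisfied-p {(1 , true) ∷ (2 , true) ∷ []} (here refl) kl nothing)) (satisfied⇒NotUnit ((1 , true) ∷ (2 , true) ∷ []) M mx (here refl) nothing))
             (XP-satisfied-x {(1 , true) ∷ (2 , true) ∷ []} (there (here refl)) kl' nothing))

  trailBound : ℕ
  trailBound = n + n + 5

  totalLength : List (Trail × Clause) → ℕ
  totalLength rs = sum (map (length ∘ proj₁) rs)

  length-zeros : ∀ m → length (zeros m) ≤ m + m
  length-zeros zero = z≤n
  length-zeros (suc zero) = z<s
  length-zeros (suc (suc k)) = begin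
    length (zeros (suc k) ++ zeroStep (suc k)) ≡⟨ length-++ (zeros (suc k)) ⟩
    length (zeros (suc k)) + 2                 ≤⟨ +-monoˡ-≤ 2 (length-zeros (suc k)) ⟩
    suc k + suc k + 2                          ≡⟨ rearrange k ⟩
    suc (suc k) + suc (suc k)                  ∎
    where
    open ≤-Reasoning
    rearrange : ∀ k → suc k + suc k + 2 ≡ suc (suc k) + suc (suc k)
    rearrange = solve-∀

  length-trail : ∀ m ext → m ≤ n → length ext ≤ 5 → length (zeros m ++ ext) ≤ trailBound
  length-trail m ext le h = subst (_≤ trailBound) (sym (length-++ (zeros m))) (+-mono-≤ (≤-trans (length-zeros m) (+-mono-≤ le le)) h)

  4≤trailBound : 4 ≤ trailBound
  4≤trailBound = ≤-trans (s≤s (s≤s sz<ss)) (m≤n+m 5 (n + n))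

  four-trails-≤ : ∀ {a b c d r X} → a ≤ trailBound → b ≤ trailBound → c ≤ trailBound → d ≤ trailBound → r ≤ X →
                  a + (b + (c + (d + r))) ≤ 4 * trailBound + X
  four-trails-≤ {a} {b} {c} {d} {r} {X} a≤ b≤ c≤ d≤ r≤ =
    subst (a + (b + (c + (d + r))) ≤_) (sym (unfold trailBound X)) (+-mono-≤ a≤ (+-mono-≤ b≤ (+-mono-≤ c≤ (+-mono-≤ d≤ r≤))))
    where
    unfold : ∀ w x → 4 * w + x ≡ w + (w + (w + (w + x)))
    unfold = solve-∀

  learntXP : ℕ → Clause → Clause
  learntXP m Pc = learnStep P (n + suc m , false) (parityClause (suc m) true true) (red P Pc)

  RefutationFrom : ℕ → List Clause → Trail → Clause → Set
  RefutationFrom k S τ C = Σ (List (Trail × Clause)) λ rest → Chain P S τ rest × finalClause C rest ≡ [] × totalLength rest ≤ suc k * (4 * trailBound)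

  ⊇Matrix-∷ʳ : ∀ {S C} → ⊇Matrix S → ⊇Matrix (S ++ C ∷ [])
  ⊇Matrix-∷ʳ mi m = ∈-++⁺ˡ (mi m)

  stage-base : ∀ {S Pc Nc} → Invariant 2 S → ⊇Matrix S → Pc ∈ S → Nc ∈ S → TZ 2 true Pc → TZ 2 false Nc → 2 ≤ n →
               RefutationFrom 0 (S ++ learntXP 1 Pc ∷ []) (trailC 1 Pc) (learntXP 1 Pc)
  stage-base {S} {Pc} {Nc} inv mi mP mN kP kN le =
    rest , chain , fin , len
    where
    L2 = learntXP 1 Pc
    kl2 : XP 2 true L2
    kl2 = learnt-XP {2} {Pc} true ≤-refl le kP
    S1 = S ++ L2 ∷ []
    M = learnStep P (2 , true) L2 (learnStep P (n + 2 , true) (parityClause 2 false true) (red P Nc))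
    lr = learnt-TZ {2} {Nc} {L2} true ≤-refl le kN kl2
    subM = proj₁ lr
    mxM = proj₁ (proj₂ lr)
    S2 = S1 ++ M ∷ []
    M' = learnStep P (n + 2 , true) (parityClause 2 true false) (red P Nc)
    kl' : XP 2 false M'
    kl' = learnt-XP {2} {Nc} false ≤-refl le kN
    S3 = S2 ++ M' ∷ []
    open TrailsEF M M' Nc Pc
    lr2 = learnt-TZ {2} {Pc} {M'} false ≤-refl le kP kl'
    rest = (trailD 1 L2 Nc , M) ∷ (trailE , M') ∷ (trailF , C3) ∷ []
    chain : Chain P S1 (trailC 1 Pc) rest
    chain = step (trailD-ok (⊇Matrix-∷ʳ mi) (∈-∷ʳ S) (∈-++⁺ˡ mN) kl2 kN ≤-refl le) (trailD-learns 1 L2 Nc)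
      (trailD-restart {S} {L2} {Pc} {Nc} {1} inv kl2 ≤-refl le)
           (step (trailE-ok (⊇Matrix-∷ʳ (⊇Matrix-∷ʳ mi)) (∈-∷ʳ S1) (∈-++⁺ˡ (∈-++⁺ˡ mN)) subM mxM kN) trailE-learns (trailE-restart inv kl2 mxM)
           (step
             (trailF-ok (⊇Matrix-∷ʳ (⊇Matrix-∷ʳ (⊇Matrix-∷ʳ mi))) (∈-++⁺ˡ (∈-∷ʳ S1)) (∈-∷ʳ S2) (∈-++⁺ˡ (∈-++⁺ˡ (∈-++⁺ˡ mP))) subM mxM kl' kP) trailF-learns
             (trailF-restart inv kl2 mxM kl')
           done))
    fin : C3 ≡ []
    fin = learnt-empty (proj₁ (proj₂ lr2)) (proj₁ lr2) subM
    len : totalLength rest ≤ 1 * (4 * trailBound)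
    len = four-trails-≤ (length-trail 1 (trailD-tail 1 L2 Nc) 1≤n (s≤s sz<ss)) 4≤trailBound 4≤trailBound z≤n z≤n
  Invariant-step : ∀ {k S L₂ P′ L₁ N′} → Invariant (3 + k) S → 3 + k ≤ n →
                   XP (3 + k) true L₂ → TZ (2 + k) true P′ → XP (3 + k) false L₁ → TZ (2 + k) false N′ →
                   Invariant (2 + k) ((((S ++ L₂ ∷ []) ++ P′ ∷ []) ++ L₁ ∷ []) ++ N′ ∷ [])
  Invariant-step {k} {S} {L₂} {P′} {L₁} inv 3+k≤n xp₂ tzP xp₁ tzN =
    ∈-∷ʳ-elim {S = ((S ++ L₂ ∷ []) ++ P′ ∷ []) ++ L₁ ∷ []}
      (∈-∷ʳ-elim {S = (S ++ L₂ ∷ []) ++ P′ ∷ []}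
        (∈-∷ʳ-elim {S = S ++ L₂ ∷ []}
          (∈-∷ʳ-elim {S = S} (Sum.map₂ Learnt-suc ∘ inv) (inj₂ (inj₂ (3 + k , true , ≤-refl , 3+k≤n , xp₂))))
          (inj₂ (inj₁ (2 + k , true , ≤-refl , <⇒≤ 3+k≤n , tzP))))
        (inj₂ (inj₂ (3 + k , false , ≤-refl , 3+k≤n , xp₁))))
      (inj₂ (inj₁ (2 + k , false , ≤-refl , <⇒≤ 3+k≤n , tzN)))

  stage : ∀ k {S Pc Nc} → Invariant (2 + k) S → ⊇Matrix S → Pc ∈ S → Nc ∈ S → TZ (2 + k) true Pc → TZ (2 + k) false Nc → 2 + k ≤ n →
           RefutationFrom k (S ++ learntXP (suc k) Pc ∷ []) (trailC (suc k) Pc) (learntXP (suc k) Pc)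
  stage zero = stage-base
  stage (suc k) {S} {Pc} {Nc} inv mi mP mN kP kN le =
    rest , chain , fin , len
    where
    open TrailsAB k
    h3 : 2 ≤ 3 + k
    h3 = sz<ss
    le' : 2 + k ≤ n
    le' = <⇒≤ le
    L2 = learntXP (2 + k) Pc
    kl2 : XP (3 + k) true L2
    kl2 = learnt-XP {3 + k} {Pc} true h3 le kP
    S1 = S ++ L2 ∷ []
    P' = learnStep P (3 + k , true) L2 (learnStep P (n + (3 + k) , true) (parityClause (3 + k) false true) (red P Nc))
    lrP = learnt-TZ {3 + k} {Nc} {L2} true h3 le kN kl2
    ktP' : TZ (2 + k) true P'
    ktP' = proj₁ lrP , proj₁ (proj₂ lrP) , proj₁ (proj₂ (proj₂ lrP)) (s≤s sz<ss)
    S2 = S1 ++ P' ∷ []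
    L1 = learnStep P (n + (3 + k) , true) (parityClause (3 + k) true false) (red P Nc)
    kl1 : XP (3 + k) false L1
    kl1 = learnt-XP {3 + k} {Nc} false h3 le kN
    S3 = S2 ++ L1 ∷ []
    N' = learnStep P (3 + k , true) L1 (learnStep P (n + (3 + k) , false) (parityClause (3 + k) false false) (red P Pc))
    lrN = learnt-TZ {3 + k} {Pc} {L1} false h3 le kP kl1
    ktN' : TZ (2 + k) false N'
    ktN' = proj₁ lrN , proj₁ (proj₂ lrN) , proj₁ (proj₂ (proj₂ lrN)) (s≤s sz<ss)
    S4 = S3 ++ N' ∷ []
    inv4 : Invariant (2 + k) S4
    inv4 = Invariant-step inv le kl2 ktP' kl1 ktN'
    mi4 : ⊇Matrix S4
    mi4 = ⊇Matrix-∷ʳ (⊇Matrix-∷ʳ (⊇Matrix-∷ʳ (⊇Matrix-∷ʳ mi)))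
    rec = stage k {S4} {P'} {N'} inv4 mi4 (∈-++⁺ˡ (∈-++⁺ˡ (∈-∷ʳ S1))) (∈-∷ʳ S3) ktP' ktN' le'
    rest' = proj₁ rec
    rest = (trailD (2 + k) L2 Nc , P') ∷ (trailA Nc , L1) ∷ (trailB L1 Pc , N') ∷ (trailC (suc k) P' , learntXP (suc k) P') ∷ rest'
    chain : Chain P S1 (trailC (2 + k) Pc) rest
    chain = step (trailD-ok (⊇Matrix-∷ʳ mi) (∈-∷ʳ S) (∈-++⁺ˡ mN) kl2 kN z<s le) (trailD-learns (2 + k) L2 Nc)
      (trailD-restart {S} {L2} {Pc} {Nc} {2 + k} inv kl2 z<s le)
           (step (trailA-ok (⊇Matrix-∷ʳ (⊇Matrix-∷ʳ mi)) (∈-++⁺ˡ (∈-++⁺ˡ mN)) kN le) (trailA-learns Nc)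
             (trailA-restart {S} {L2} {P'} {Nc} inv kl2 ktP' le)
           (step (trailB-ok (⊇Matrix-∷ʳ (⊇Matrix-∷ʳ (⊇Matrix-∷ʳ mi))) (∈-∷ʳ S2) (∈-++⁺ˡ (∈-++⁺ˡ (∈-++⁺ˡ mP))) kl1 kP le)
             (trailB-learns L1 Pc) (trailB-restart {S} {L2} {P'} {L1} {Pc} {Nc} inv kl2 ktP' kl1 le)
           (step (trailC-ok mi4 (∈-++⁺ˡ (∈-++⁺ˡ (∈-∷ʳ S1))) ktP' z<s le') (trailC-learns (suc k) P')
                 (restart P S4 (zeros (suc k)) _ (trailB L1 Pc) (trailB-tail L1 Pc) refl (trailC-natural sz<ss inv4 (suc k) P' le' ≤-refl))
           (proj₁ (proj₂ rec)))))
    fin : finalClause L2 rest ≡ []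
    fin = proj₁ (proj₂ (proj₂ rec))
    len : totalLength rest ≤ suc (suc k) * (4 * trailBound)
    len = four-trails-≤ (length-trail (2 + k) (trailD-tail (2 + k) L2 Nc) (<⇒≤ le) (s≤s sz<ss))
                 (length-trail (suc k) (trailA-tail Nc) (<⇒≤ le') ≤-refl)
                 (length-trail (suc k) (trailB-tail L1 Pc) (<⇒≤ le') ≤-refl)
                 (length-trail (suc k) _ (<⇒≤ le') (s≤s sz<ss))
                 (proj₂ (proj₂ (proj₂ rec)))

module _ (k : ℕ) where

  open QParityRefutation (2 + k) sz<ss

  private
    tail = stage k Invariant-Matrix (λ C∈ → C∈) finalPos∈Matrix finalNeg∈Matrix TZ-finalPos TZ-finalNeg ≤-refl

  QParity-refutation : Refutation (QParity (2 + k))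
  QParity-refutation = record
    { trail₁ = trailC (suc k) finalPos
    ; clause₁ = learntXP (suc k) finalPos
    ; rest = proj₁ tail
    ; trail₁OK = trailC-ok (λ C∈ → C∈) finalPos∈Matrix TZ-finalPos z<s ≤-refl
    ; natural₁ = naturalFrom P Matrix [] (trailC (suc k) finalPos)
        (AllAfter-++ (NaturalAt P Matrix) [] (zeros (suc k)) _
          (zeros-natural sz<ss Invariant-Matrix (suc k) (n≤1+n _) (n≤1+n _))
          (trailC-natural sz<ss Invariant-Matrix (suc k) finalPos ≤-refl ≤-refl))
    ; learnt₁ = trailC-learns (suc k) finalPos
    ; chain = proj₁ (proj₂ tail)
    ; endsEmpty = proj₁ (proj₂ (proj₂ tail))
    }

  size-QParity-refutation : size QParity-refutation ≤ 20 * (2 + k) ^ 2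
  size-QParity-refutation =
    ≤-trans (+-mono-≤ (length-trail (suc k) _ (n≤1+n _) (s≤s sz<ss)) (proj₂ (proj₂ (proj₂ tail))))
            (subst (trailBound + suc k * (4 * trailBound) ≤_) (slack k) (m≤m+n _ _))
    where
    -- (2n + 5)(4k + 5) plus a non-negative slack is 20 n², for n = k + 2.
    slack : ∀ k → (2 + k + (2 + k) + 5) + (1 + k) * (4 * (2 + k + (2 + k) + 5)) + (35 + 34 * k + 12 * (k * k))
                  ≡ 20 * ((2 + k) * ((2 + k) * 1))
    slack = solve-∀

proposition4p2 : ∃[ c ] ∃[ k ] ((n : ℕ) → 2 ≤ n →
                     Σ (Refutation (QParity n)) λ R → size R ≤ c * n ^ k)
proposition4p2 = 20 , 2 , λ where
  (suc (suc k)) (s≤s (s≤s z≤n)) → QParity-refutation k , size-QParity-refutation k
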